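{- Let $q=4$ or $q\ge 7$ be a prime power, and let \[ S_2=\{e_0\}\cup\{e_0+ae_1\}\cup\{e_1+ae_2+a^2e_3\}\cup\{e_2\}\cup\{e_3+ae_4+a^2e_5\}\cup\{e_4,e_5\}\subset\mathrm{PG}(5,q), \] where $a$ ranges over $\mathbb{F}_q^*$ in each set. Then: (i) the $(3q+1)$-set $S_2$ is a minimal $2$-saturating set in $\mathrm{PG}(5,q)$; (ii) the set of points of $\mathrm{PG}(5,q)$ that are not $2$-covered by $S_2\setminus\{e_5\}$ is a proper subset of \[ M_2=\{(x_0,\dots,x_5): x_4=0,\ x_5\ne0,\ (x_0,x_1,x_2,x_3)\notin M_1\}, \] where $M_1=\{(x_0,x_1,x_2,x_3)\in\mathbb{F}_q^4: x_2=0,\ x_3\neq 0,\ \text{and not }(x_0=0\text{ and }x_1\ne0)\}$; (iii) the $3q$-set $S_2\setminus\{e_5\}$ is $3$-saturating in $\mathrm{PG}(5,q)$.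
   Context: Points of $\mathrm{PG}(5,q)$ are written in homogeneous coordinates $(x_0,\dots,x_5)$; $e_0,\dots,e_5$ are the standard unit vectors. A point set $S\subseteq\mathrm{PG}(N,q)$ is $\rho$-saturating if every point of $\mathrm{PG}(N,q)$ is a linear combination of at most $\rho+1$ points of $S$, and $\rho$ is the smallest value with this property; it is minimal if it contains no smaller $\rho$-saturating set. A point is $\rho$-covered by a set $X$ if it is a linear combination of at most $\rho+1$ points of $X$. -}

module Defs where

open import Level using (0ℓ)
open import Data.Nat using (ℕ; zero; suc; _≤_)
open import Data.Fin using (Fin; zero; suc)
open import Data.Product using (Σ; ∃; _×_; _,_)
open import Data.Sum using (_⊎_)
open import Relation.Nullary using (¬_)
open import Relation.Binary.PropositionalEquality using (_≡_; _≢_; _≗_)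
open import Algebra.Structures using (IsCommutativeRing)
open import Function.Bundles using (_↔_)

-- A finite field with exactly q elements (equality is propositional equality;
-- every finite field is isomorphic to one of this form).
record FiniteField (q : ℕ) : Set₁ where
  infixl 6 _+_
  infixl 7 _*_
  field
    Carrier : Set
    _+_ _*_ : Carrier → Carrier → Carrier
    -_ : Carrier → Carrier
    0# 1# : Carrier
    isCommutativeRing : IsCommutativeRing _≡_ _+_ _*_ -_ 0# 1#
    0≢1 : 0# ≢ 1#
    inverse : ∀ x → x ≢ 0# → ∃ λ y → x * y ≡ 1#
    enumeration : Fin q ↔ Carrier

module PG5 {q : ℕ} (𝔽 : FiniteField q) where
  open FiniteField 𝔽

  -- vectors of F_q^6 (homogeneous coordinates of PG(5,q))
  V : Set
  V = Fin 6 → Carrier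

  zeroV : V
  zeroV _ = 0#

  _+V_ : V → V → V
  (u +V v) i = u i + v i

  _·_ : Carrier → V → V
  (c · v) i = c * v i

  e : Fin 6 → V
  e zero    zero    = 1#
  e zero    (suc _) = 0#
  e (suc j) zero    = 0#
  e (suc j) (suc i) = e′ j i
    where
    e′ : Fin 5 → Fin 5 → Carrier
    e′ zero    zero    = 1#
    e′ zero    (suc _) = 0#
    e′ (suc _) zero    = 0#
    e′ (suc j) (suc i) = e″ j i
      where
      e″ : Fin 4 → Fin 4 → Carrier
      e″ j i with Data.Fin._≟_ j i
      ... | Relation.Nullary.yes _ = 1#
      ... | Relation.Nullary.no _  = 0#

  NonZeroV : V → Set
  NonZeroV v = ¬ (v ≗ zeroV)

  Proportional : V → V → Set
  Proportional u v = Σ Carrier λ c → c ≢ 0# × (u ≗ c · v)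

  -- point sets of PG(5,q), given by (some) representative vectors
  PointSet : Set₁
  PointSet = V → Set

  _∈ₚ_ : V → PointSet → Set
  v ∈ₚ X = Σ V λ w → X w × Proportional w v

  _⊆ₚ_ : PointSet → PointSet → Set
  X ⊆ₚ Y = ∀ w → X w → w ∈ₚ Y

  _⊂ₚ_ : PointSet → PointSet → Set
  X ⊂ₚ Y = X ⊆ₚ Y × (Σ V λ w → Y w × ¬ (w ∈ₚ X))

  _∖ₚ_ : PointSet → V → PointSet
  (X ∖ₚ p) w = X w × ¬ Proportional w p

  lincomb : (k : ℕ) → (Fin k → Carrier) → (Fin k → V) → V
  lincomb zero    c p = zeroV
  lincomb (suc k) c p = (c zero · p zero) +V lincomb k (λ i → c (suc i)) (λ i → p (suc i))

  Covered : ℕ → PointSet → V → Set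
  Covered ρ X v =
    Σ ℕ λ k → k ≤ suc ρ ×
      (Σ (Fin k → V) λ p → (∀ i → X (p i)) ×
        (Σ (Fin k → Carrier) λ c → v ≗ lincomb k c p))

  Covers : ℕ → PointSet → Set
  Covers ρ X = ∀ v → NonZeroV v → Covered ρ X v

  Saturating : ℕ → PointSet → Set
  Saturating ρ X = Covers ρ X × (∀ ρ′ → suc ρ′ ≤ ρ → ¬ Covers ρ′ X)

  MinimalSaturating : ℕ → PointSet → Set₁
  MinimalSaturating ρ X = Saturating ρ X × (∀ T → T ⊂ₚ X → ¬ Saturating ρ T)

  HasSize : ℕ → PointSet → Set
  HasSize n X =
    Σ (Fin n → V) λ f → (∀ i → X (f i)) × (∀ w → X w → Σ (Fin n) λ i → Proportional w (f i))
      × (∀ i j → Proportional (f i) (f j) → i ≡ j)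

  ℓ₀ ℓ₁ ℓ₂ ℓ₃ ℓ₄ ℓ₅ : Fin 6
  ℓ₀ = zero
  ℓ₁ = suc zero
  ℓ₂ = suc (suc zero)
  ℓ₃ = suc (suc (suc zero))
  ℓ₄ = suc (suc (suc (suc zero)))
  ℓ₅ = suc (suc (suc (suc (suc zero))))

  -- the set S₂ (one representative per point; a ranges over F_q^*)
  S₂ : PointSet
  S₂ v =
    (v ≗ e ℓ₀)
    ⊎ (Σ Carrier λ a → a ≢ 0# × (v ≗ e ℓ₀ +V (a · e ℓ₁)))
    ⊎ (Σ Carrier λ a → a ≢ 0# × (v ≗ e ℓ₁ +V ((a · e ℓ₂) +V ((a * a) · e ℓ₃))))
    ⊎ (v ≗ e ℓ₂)
    ⊎ (Σ Carrier λ a → a ≢ 0# × (v ≗ e ℓ₃ +V ((a · e ℓ₄) +V ((a * a) · e ℓ₅))))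
    ⊎ (v ≗ e ℓ₄)
    ⊎ (v ≗ e ℓ₅)

  M₁ : Carrier → Carrier → Carrier → Carrier → Set
  M₁ x₀ x₁ x₂ x₃ = (x₂ ≡ 0#) × (x₃ ≢ 0#) × ¬ ((x₀ ≡ 0#) × (x₁ ≢ 0#))

  M₂ : V → Set
  M₂ x = (x ℓ₄ ≡ 0#) × (x ℓ₅ ≢ 0#) × ¬ M₁ (x ℓ₀) (x ℓ₁) (x ℓ₂) (x ℓ₃)

module Submission where

-- A ring solver with integer coefficients and a few counting
-- facts about a finite field (an element avoiding fewer than q bad values
-- exists; for q = 4 the characteristic is 2 and every element is a square)
-- handle the arithmetic.  The geometric core is that a vector (y, z, t) with
-- at most one zero coordinate lies on a secant of the conic {(1, a, a²)}
-- through two points with nonzero parameters; the conics {C a} and {E a} of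
-- S₂ thus cover the planes ⟨e₁, e₂, e₃⟩ and ⟨e₃, e₄, e₅⟩ with two points.
-- A case analysis on (x₄, x₅) shows that every vector outside M₂ is a
-- combination of at most three points of S₂ ∖ {e₅}.  For the lower bounds,
-- a combination of points of S₂ splits into a part in ⟨e₀, …, e₃⟩ and a part
-- in ⟨e₃, e₄, e₅⟩; this yields, for every point w₀ of S₂, a witness vector
-- that is not 2-covered by S₂ ∖ {w₀}, giving minimality.  The sizes follow
-- from indexing the points by Fin 3 × F (plus e₅), with the index decoded
-- from the first nonzero coordinate.

open import Defs
open import Level using (0ℓ)
open import Data.Nat using (ℕ; zero; suc; _≤_; _<_; z≤n; s≤s)
import Data.Nat as ℕ
import Data.Nat.Properties as ℕP
open import Data.Integer using (ℤ; -[1+_]; _⊖_; sign; ∣_∣; _◃_)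
import Data.Integer as ℤ
import Data.Integer.Properties as ℤP
open import Data.Sign using (Sign)
import Data.Sign as Sign
open import Data.Fin using (Fin; zero; suc)
import Data.Fin as Fin
import Data.Fin.Properties as FinP
open import Data.Fin.Properties using (*↔×; +↔⊎; 1↔⊤)
open import Data.Maybe using (Maybe; just; nothing)
open import Data.Product using (Σ; _×_; _,_; proj₁; proj₂)
open import Data.Product.Function.NonDependent.Propositional using (_×-↔_)
open import Data.Sum using (_⊎_; inj₁; inj₂)
open import Data.Sum.Function.Propositional using (_⊎-↔_)
open import Data.Sum.Properties using (inj₁-injective)
open import Data.Unit using (⊤; tt)
open import Data.Empty using (⊥; ⊥-elim)
open import Data.List using (List; []; _∷_; length; filter; tabulate; lookup)
import Data.List.Properties as LP
open import Data.List.Relation.Unary.Any using (Any; here; there; index)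
import Data.List.Relation.Unary.Any as Any
open import Data.List.Relation.Unary.Any.Properties using (lookup-index)
import Data.List.Relation.Unary.All as All
open import Data.List.Relation.Unary.All using ([]; _∷_)
open import Data.List.Relation.Unary.AllPairs using ([]; _∷_)
open import Data.List.Relation.Unary.Unique.Propositional using (Unique)
open import Data.List.Membership.Propositional using (_∈_)
import Data.List.Membership.Propositional.Properties as MP
open import Relation.Nullary using (¬_; Dec; yes; no)
open import Relation.Nullary.Decidable using (¬?; _×-dec_)
open import Relation.Unary using (Pred; Decidable)
open import Relation.Binary.PropositionalEquality
open import Function.Bundles using (_↔_; Inverse)
open import Function.Properties.Inverse using (↔-refl; ↔-trans)
open import Algebra.Bundles using (CommutativeRing)
open import Algebra.Structures using (IsCommutativeRing)
open import Algebra.Solver.Ring.AlmostCommutativeRing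
  using (fromCommutativeRing; _-Raw-AlmostCommutative⟶_)

-- Integer equality is decidable by
-- computation, so identities such as (a + b)(a − b) = a² − b², whose
-- normalisation cancels coefficients, are proved by 'solve'.
module IntegerRingSolver
  {A : Set} {add mul : A → A → A} {neg : A → A} {zer one : A}
  (isCR : IsCommutativeRing _≡_ add mul neg zer one) where

  private
    R : CommutativeRing 0ℓ 0ℓ
    R = record { isCommutativeRing = isCR }

    open CommutativeRing R
      using (_+_; _*_; -_; 0#; 1#; +-identityˡ; +-identityʳ; +-assoc; +-comm; -‿inverseʳ;
             *-identityˡ; *-identityʳ; zeroʳ; *-assoc; *-comm; +-abelianGroup; +-group; ring; semiring)
    open import Algebra.Properties.AbelianGroup +-abelianGroup using (⁻¹-∙-comm)
    open import Algebra.Properties.Group +-group using (⁻¹-involutive; ε⁻¹≈ε)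
    open import Algebra.Properties.Ring ring using (-1*x≈-x)
    open import Algebra.Properties.Semiring.Mult.TCOptimised semiring
      using (1+×; ×-homo-+; ×1-homo-*) renaming (_×_ to _×′_)
    open ≡-Reasoning

    -- the image n·1 of a natural number (with 1·1 = 1 definitionally)
    nat : ℕ → A
    nat n = n ×′ 1#

    ⟦_⟧ : ℤ → A
    ⟦ ℤ.+ n ⟧ = nat n
    ⟦ -[1+ n ] ⟧ = - nat (suc n)

    neg-+ : ∀ a b → - (a + b) ≡ - a + - b
    neg-+ a b = sym (⁻¹-∙-comm a b)

    cancel-1 : ∀ a b → (1# + a) + - (1# + b) ≡ a + - b
    cancel-1 a b = begin
      (1# + a) + - (1# + b)   ≡⟨ cong ((1# + a) +_) (neg-+ 1# b) ⟩
      (1# + a) + (- 1# + - b) ≡⟨ +-assoc 1# a _ ⟩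
      1# + (a + (- 1# + - b)) ≡⟨ cong (1# +_) (trans (sym (+-assoc a _ _)) (trans (cong (_+ - b) (+-comm a (- 1#))) (+-assoc _ a _))) ⟩
      1# + (- 1# + (a + - b)) ≡⟨ sym (+-assoc 1# _ _) ⟩
      (1# + - 1#) + (a + - b) ≡⟨ cong (_+ (a + - b)) (-‿inverseʳ 1#) ⟩
      0# + (a + - b)          ≡⟨ +-identityˡ _ ⟩
      a + - b                 ∎

    ⊖-homo : ∀ m n → ⟦ m ⊖ n ⟧ ≡ nat m + - nat n
    ⊖-homo zero zero = sym (trans (cong (0# +_) ε⁻¹≈ε) (+-identityʳ 0#))
    ⊖-homo zero (suc n) = sym (+-identityˡ _)
    ⊖-homo (suc m) zero = sym (trans (cong (nat (suc m) +_) ε⁻¹≈ε) (+-identityʳ _))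
    ⊖-homo (suc m) (suc n) = begin
      ⟦ suc m ⊖ suc n ⟧             ≡⟨ cong ⟦_⟧ (ℤP.[1+m]⊖[1+n]≡m⊖n m n) ⟩
      ⟦ m ⊖ n ⟧                     ≡⟨ ⊖-homo m n ⟩
      nat m + - nat n               ≡⟨ sym (cancel-1 _ _) ⟩
      (1# + nat m) + - (1# + nat n) ≡⟨ sym (cong₂ (λ a b → a + - b) (1+× m 1#) (1+× n 1#)) ⟩
      nat (suc m) + - nat (suc n)   ∎

    +-homo : ∀ i j → ⟦ i ℤ.+ j ⟧ ≡ ⟦ i ⟧ + ⟦ j ⟧
    +-homo (ℤ.+ m) (ℤ.+ n) = ×-homo-+ 1# m n
    +-homo (ℤ.+ m) -[1+ n ] = ⊖-homo m (suc n)
    +-homo -[1+ m ] (ℤ.+ n) = trans (⊖-homo n (suc m)) (+-comm _ _)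
    +-homo -[1+ m ] -[1+ n ] = begin
      - nat (suc (suc (m ℕ.+ n)))       ≡⟨ cong (λ k → - nat k) (sym (ℕP.+-suc (suc m) n)) ⟩
      - nat (suc m ℕ.+ suc n)           ≡⟨ cong -_ (×-homo-+ 1# (suc m) (suc n)) ⟩
      - (nat (suc m) + nat (suc n))     ≡⟨ neg-+ _ _ ⟩
      - nat (suc m) + - nat (suc n)     ∎

    neg-homo : ∀ i → ⟦ ℤ.- i ⟧ ≡ - ⟦ i ⟧
    neg-homo -[1+ n ] = sym (⁻¹-involutive _)
    neg-homo (ℤ.+ zero) = sym ε⁻¹≈ε
    neg-homo (ℤ.+ suc n) = refl

    -- multiplication is handled through the decomposition i = sign i · ∣ i ∣
    ⟦_⟧ₛ : Sign → A
    ⟦ Sign.+ ⟧ₛ = 1#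
    ⟦ Sign.- ⟧ₛ = - 1#

    sign-homo : ∀ s t → ⟦ s Sign.* t ⟧ₛ ≡ ⟦ s ⟧ₛ * ⟦ t ⟧ₛ
    sign-homo Sign.+ t = sym (*-identityˡ _)
    sign-homo Sign.- Sign.+ = sym (*-identityʳ (- 1#))
    sign-homo Sign.- Sign.- = sym (trans (-1*x≈-x (- 1#)) (⁻¹-involutive _))

    ◃-homo : ∀ s n → ⟦ s ◃ n ⟧ ≡ ⟦ s ⟧ₛ * nat n
    ◃-homo s zero = sym (zeroʳ _)
    ◃-homo Sign.+ (suc n) = sym (*-identityˡ _)
    ◃-homo Sign.- (suc n) = sym (-1*x≈-x _)

    sign-abs : ∀ i → ⟦ i ⟧ ≡ ⟦ sign i ⟧ₛ * nat ∣ i ∣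
    sign-abs (ℤ.+ n) = sym (*-identityˡ _)
    sign-abs -[1+ n ] = sym (-1*x≈-x _)

    interchange : ∀ a b c d → (a * b) * (c * d) ≡ (a * c) * (b * d)
    interchange a b c d = begin
      (a * b) * (c * d) ≡⟨ *-assoc a b _ ⟩
      a * (b * (c * d)) ≡⟨ cong (a *_) (trans (sym (*-assoc b c d)) (cong (_* d) (*-comm b c))) ⟩
      a * ((c * b) * d) ≡⟨ cong (a *_) (*-assoc c b d) ⟩
      a * (c * (b * d)) ≡⟨ sym (*-assoc a c _) ⟩
      (a * c) * (b * d) ∎

    *-homo : ∀ i j → ⟦ i ℤ.* j ⟧ ≡ ⟦ i ⟧ * ⟦ j ⟧
    *-homo i j = begin
      ⟦ (sign i Sign.* sign j) ◃ (∣ i ∣ ℕ.* ∣ j ∣) ⟧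
        ≡⟨ ◃-homo (sign i Sign.* sign j) (∣ i ∣ ℕ.* ∣ j ∣) ⟩
      ⟦ sign i Sign.* sign j ⟧ₛ * nat (∣ i ∣ ℕ.* ∣ j ∣)
        ≡⟨ cong₂ _*_ (sign-homo (sign i) (sign j)) (×1-homo-* ∣ i ∣ ∣ j ∣) ⟩
      (⟦ sign i ⟧ₛ * ⟦ sign j ⟧ₛ) * (nat ∣ i ∣ * nat ∣ j ∣)
        ≡⟨ interchange _ _ _ _ ⟩
      (⟦ sign i ⟧ₛ * nat ∣ i ∣) * (⟦ sign j ⟧ₛ * nat ∣ j ∣)
        ≡⟨ sym (cong₂ _*_ (sign-abs i) (sign-abs j)) ⟩
      ⟦ i ⟧ * ⟦ j ⟧ ∎

    homomorphism : ℤ.+-*-rawRing -Raw-AlmostCommutative⟶ fromCommutativeRing R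
    homomorphism = record
      { ⟦_⟧ = ⟦_⟧ ; +-homo = +-homo ; *-homo = *-homo ; -‿homo = neg-homo
      ; 0-homo = refl ; 1-homo = refl }

    coefficient≟ : ∀ i j → Maybe (⟦ i ⟧ ≡ ⟦ j ⟧)
    coefficient≟ i j with i ℤ.≟ j
    ... | yes i≡j = just (cong ⟦_⟧ i≡j)
    ... | no _ = nothing

  open import Algebra.Solver.Ring ℤ.+-*-rawRing (fromCommutativeRing R) homomorphism coefficient≟ public
    using (Polynomial; solve; _:=_; _:+_; _:*_; :-_; _:-_; con)

  c0 c1 : ∀ {n} → Polynomial n
  c0 = con (ℤ.+ 0)
  c1 = con (ℤ.+ 1)

lookup-injective : ∀ {A : Set} {xs : List A} → Unique xs → ∀ i j → lookup xs i ≡ lookup xs j → i ≡ j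
lookup-injective (_ ∷ _) zero zero _ = refl
lookup-injective (x∉xs ∷ _) zero (suc j) e = ⊥-elim (All.lookup x∉xs (MP.∈-lookup j) e)
lookup-injective (x∉xs ∷ _) (suc i) zero e = ⊥-elim (All.lookup x∉xs (MP.∈-lookup i) (sym e))
lookup-injective (_ ∷ u) (suc i) (suc j) e = cong suc (lookup-injective u i j e)

module FiniteFieldFacts {q : ℕ} (𝔽 : FiniteField q) where

  open FiniteField 𝔽
  open IsCommutativeRing isCommutativeRing public
    using (+-assoc; +-comm; +-identityˡ; +-identityʳ; -‿inverseʳ;
           *-assoc; *-comm; *-identityˡ; *-identityʳ; zeroˡ; zeroʳ)
  open IntegerRingSolver isCommutativeRing public
  open Inverse enumeration using (to; from; strictlyInverseˡ; strictlyInverseʳ)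

  infixl 6 _−_
  _−_ : Carrier → Carrier → Carrier
  x − y = x + - y

  two : Carrier
  two = 1# + 1#

  1≢0 : 1# ≢ 0#
  1≢0 1≡0 = 0≢1 (sym 1≡0)

  to-injective : ∀ {i j} → to i ≡ to j → i ≡ j
  to-injective {i} {j} e = trans (sym (strictlyInverseʳ i)) (trans (cong from e) (strictlyInverseʳ j))

  infix 4 _≟_
  _≟_ : (x y : Carrier) → Dec (x ≡ y)
  x ≟ y with from x Fin.≟ from y
  ... | yes p = yes (trans (sym (strictlyInverseˡ x)) (trans (cong to p) (strictlyInverseˡ y)))
  ... | no ¬p = no (λ x≡y → ¬p (cong from x≡y))

  ≢-stable : ∀ {x y} → ¬ (x ≢ y) → x ≡ y
  ≢-stable {x} {y} ¬x≢y with x ≟ y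
  ... | yes x≡y = x≡y
  ... | no x≢y = ⊥-elim (¬x≢y x≢y)

  search : {P : Pred Carrier 0ℓ} → Decidable P → Σ Carrier P ⊎ (∀ a → ¬ P a)
  search {P} P? with FinP.any? (λ i → P? (to i))
  ... | yes (i , p) = inj₁ (to i , p)
  ... | no none = inj₂ λ a pa → none (from a , subst P (sym (strictlyInverseˡ a)) pa)

  injection-into-list : (f : Carrier → Carrier) → (∀ {a b} → f a ≡ f b → a ≡ b) →
                        (L : List Carrier) → (∀ a → f a ∈ L) → q ≤ length L
  injection-into-list f f-inj L f∈L = FinP.injective⇒≤ position-injective
    where
    position : Fin q → Fin (length L)
    position i = index (f∈L (to i))
    position-injective : ∀ {i j} → position i ≡ position j → i ≡ j
    position-injective {i} {j} e = to-injective (f-inj (begin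
      f (to i)                  ≡⟨ lookup-index (f∈L (to i)) ⟩
      lookup L (position i)     ≡⟨ cong (lookup L) e ⟩
      lookup L (position j)     ≡⟨ sym (lookup-index (f∈L (to j))) ⟩
      f (to j)                  ∎))
      where open ≡-Reasoning

  unique⇒length≤q : ∀ {xs} → Unique xs → length xs ≤ q
  unique⇒length≤q {xs} u = FinP.injective⇒≤ {f = λ i → from (lookup xs i)} λ {i} {j} e →
    lookup-injective u i j (trans (sym (strictlyInverseˡ _)) (trans (cong to e) (strictlyInverseˡ _)))

  -- Multiplicative inverses (0⁻¹ is set to 0; only x⁻¹ for x ≠ 0 is used).

  infix 8 _⁻¹
  abstract
    _⁻¹ : Carrier → Carrier
    x ⁻¹ with x ≟ 0#
    ... | yes _ = 0#
    ... | no x≢0 = proj₁ (inverse x x≢0)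

    ⁻¹-inverseʳ : ∀ {x} → x ≢ 0# → x * x ⁻¹ ≡ 1#
    ⁻¹-inverseʳ {x} x≢0 with x ≟ 0#
    ... | yes x≡0 = ⊥-elim (x≢0 x≡0)
    ... | no x≢0′ = proj₂ (inverse x x≢0′)

  ⁻¹-inverseˡ : ∀ {x} → x ≢ 0# → x ⁻¹ * x ≡ 1#
  ⁻¹-inverseˡ {x} x≢0 = trans (*-comm (x ⁻¹) x) (⁻¹-inverseʳ x≢0)

  ⁻¹-cancelˡ : ∀ {x} y → x ≢ 0# → x ⁻¹ * (x * y) ≡ y
  ⁻¹-cancelˡ {x} y x≢0 = begin
    x ⁻¹ * (x * y) ≡⟨ sym (*-assoc _ x y) ⟩
    (x ⁻¹ * x) * y ≡⟨ cong (_* y) (⁻¹-inverseˡ x≢0) ⟩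
    1# * y         ≡⟨ *-identityˡ y ⟩
    y              ∎
    where open ≡-Reasoning

  ⁻¹-cancelʳ : ∀ {x} y → x ≢ 0# → (y * x ⁻¹) * x ≡ y
  ⁻¹-cancelʳ {x} y x≢0 = begin
    (y * x ⁻¹) * x ≡⟨ *-assoc y _ x ⟩
    y * (x ⁻¹ * x) ≡⟨ cong (y *_) (⁻¹-inverseˡ x≢0) ⟩
    y * 1#         ≡⟨ *-identityʳ y ⟩
    y              ∎
    where open ≡-Reasoning

  solve-linear : ∀ {x a b} → x ≢ 0# → x * a ≡ b → a ≡ x ⁻¹ * b
  solve-linear {x} {a} x≢0 e = trans (sym (⁻¹-cancelˡ a x≢0)) (cong (x ⁻¹ *_) e)

  solve-linearʳ : ∀ {a x b} → x ≢ 0# → a * x ≡ b → a ≡ x ⁻¹ * b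
  solve-linearʳ {a} {x} x≢0 e = solve-linear x≢0 (trans (*-comm x a) e)

  solve-linear-nonzero : ∀ {x a b} → b ≢ 0# → x * a ≡ b → a ≡ x ⁻¹ * b
  solve-linear-nonzero {x} {a} b≢0 e with x ≟ 0#
  ... | yes x≡0 = ⊥-elim (b≢0 (trans (sym e) (trans (cong (_* a) x≡0) (zeroˡ a))))
  ... | no x≢0 = solve-linear x≢0 e

  *-cancelˡ : ∀ {x a b} → x ≢ 0# → x * a ≡ x * b → a ≡ b
  *-cancelˡ {x} {a} {b} x≢0 e = trans (solve-linear x≢0 e) (⁻¹-cancelˡ b x≢0)

  no-zero-divisors : ∀ {x y} → x * y ≡ 0# → x ≡ 0# ⊎ y ≡ 0#
  no-zero-divisors {x} {y} xy≡0 with x ≟ 0#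
  ... | yes x≡0 = inj₁ x≡0
  ... | no x≢0 = inj₂ (trans (solve-linear x≢0 xy≡0) (zeroʳ (x ⁻¹)))

  *-nonzero : ∀ {x y} → x ≢ 0# → y ≢ 0# → x * y ≢ 0#
  *-nonzero x≢0 y≢0 xy≡0 with no-zero-divisors xy≡0
  ... | inj₁ x≡0 = x≢0 x≡0
  ... | inj₂ y≡0 = y≢0 y≡0

  ⁻¹-nonzero : ∀ {x} → x ≢ 0# → x ⁻¹ ≢ 0#
  ⁻¹-nonzero {x} x≢0 x⁻¹≡0 = 1≢0 (trans (sym (⁻¹-inverseʳ x≢0)) (trans (cong (x *_) x⁻¹≡0) (zeroʳ x)))

  neg-involutive : ∀ a → - (- a) ≡ a
  neg-involutive = solve 1 (λ a → :- (:- a) := a) refl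

  neg-injective : ∀ {a b} → - a ≡ - b → a ≡ b
  neg-injective {a} {b} e = trans (sym (neg-involutive a)) (trans (cong -_ e) (neg-involutive b))

  neg-zero : ∀ {x} → - x ≡ 0# → x ≡ 0#
  neg-zero {x} -x≡0 = neg-injective (trans -x≡0 (sym -0≡0))
    where -0≡0 : - 0# ≡ 0#
          -0≡0 = solve 0 (:- c0 := c0) refl

  -‿nonzero : ∀ {x} → x ≢ 0# → - x ≢ 0#
  -‿nonzero x≢0 -x≡0 = x≢0 (neg-zero -x≡0)

  −≡0⇒≡ : ∀ {x y} → x − y ≡ 0# → x ≡ y
  −≡0⇒≡ {x} {y} e = trans (sym (l x y)) (trans (cong (_+ y) e) (+-identityˡ y))
    where l : ∀ a b → (a − b) + b ≡ a
          l = solve 2 (λ a b → (a :- b) :+ b := a) refl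

  ≢⇒−≢0 : ∀ {x y} → x ≢ y → x − y ≢ 0#
  ≢⇒−≢0 x≢y e = x≢y (−≡0⇒≡ e)

  square-roots : ∀ {a r} → a * a ≡ r * r → a ≡ r ⊎ a ≡ - r
  square-roots {a} {r} e
    with no-zero-divisors (trans (sym (factor a r)) (trans (cong (_− r * r) e) (-‿inverseʳ (r * r))))
    where factor : ∀ a r → a * a − r * r ≡ (a − r) * (a + r)
          factor = solve 2 (λ a r → a :* a :- r :* r := (a :- r) :* (a :+ r)) refl
  ... | inj₁ a−r≡0 = inj₁ (−≡0⇒≡ a−r≡0)
  ... | inj₂ a+r≡0 = inj₂ (trans (l a r) (trans (cong (_− r) a+r≡0) (+-identityˡ (- r))))
    where l : ∀ a r → a ≡ (a + r) − r
          l = solve 2 (λ a r → a := (a :+ r) :- r) refl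

  element∈ : ∀ a → a ∈ tabulate to
  element∈ a = subst (_∈ tabulate to) (strictlyInverseˡ a) (MP.∈-tabulate⁺ (from a))

  avoid : {G : Pred Carrier 0ℓ} → Decidable G → (bad : List Carrier) → length bad < q →
          (∀ a → ¬ G a → a ∈ bad) → Σ Carrier G
  avoid G? bad short bad∈ with search G?
  ... | inj₁ good = good
  ... | inj₂ none = ⊥-elim (ℕP.<⇒≱ short (injection-into-list (λ a → a) (λ e → e) bad (λ a → bad∈ a (none a))))

  injective⇒surjective : (f : Carrier → Carrier) → (∀ {a b} → f a ≡ f b → a ≡ b) →
                         ∀ s → Σ Carrier λ a → f a ≡ s
  injective⇒surjective f f-inj s with search (λ a → f a ≟ s)
  ... | inj₁ hit = hit
  ... | inj₂ miss = ⊥-elim (ℕP.<⇒≱ others<q (injection-into-list f f-inj others f∈others))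
    where
    others = filter (λ x → ¬? (x ≟ s)) (tabulate to)
    others<q : length others < q
    others<q = subst (length others <_) (LP.length-tabulate to)
      (LP.filter-notAll _ (tabulate to) (Any.map (λ s≡x x≢s → x≢s (sym s≡x)) (element∈ s)))
    f∈others : ∀ a → f a ∈ others
    f∈others a = MP.∈-filter⁺ _ (element∈ (f a)) (miss a)

  nonzero-avoiding : 3 < q → ∀ u v → Σ Carrier λ y → y ≢ 0# × y ≢ u × y ≢ v
  nonzero-avoiding q>3 u v = avoid (λ y → ¬? (y ≟ 0#) ×-dec ¬? (y ≟ u) ×-dec ¬? (y ≟ v)) (0# ∷ u ∷ v ∷ []) q>3 bad∈
    where
    bad∈ : ∀ y → ¬ (y ≢ 0# × y ≢ u × y ≢ v) → y ∈ (0# ∷ u ∷ v ∷ [])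
    bad∈ y fails with y ≟ 0# | y ≟ u
    ... | yes y≡0 | _ = here y≡0
    ... | no _ | yes y≡u = there (here y≡u)
    ... | no y≢0 | no y≢u = there (there (here (≢-stable (λ y≢v → fails (y≢0 , y≢u , y≢v)))))

  -- In a field with 4 elements, 1 + 1 = 0: otherwise 0, 1, −1, y, −y would
  -- be five distinct elements for any y ∉ {0, 1, −1}.
  characteristic-two : q ≡ 4 → two ≡ 0#
  characteristic-two q≡4 with two ≟ 0#
  ... | yes two≡0 = two≡0
  ... | no two≢0 = ⊥-elim (ℕP.<⇒≱ (ℕP.n<1+n 4) (subst (5 ≤_) q≡4 (unique⇒length≤q five-distinct)))
    where
    y-facts = nonzero-avoiding (subst (3 <_) (sym q≡4) (ℕP.n<1+n 3)) 1# (- 1#)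
    y = proj₁ y-facts
    y≢0 = proj₁ (proj₂ y-facts)
    y≢1 = proj₁ (proj₂ (proj₂ y-facts))
    y≢-1 = proj₂ (proj₂ (proj₂ y-facts))
    double : ∀ x → x + x ≡ two * x
    double = solve 1 (λ x → x :+ x := (c1 :+ c1) :* x) refl
    x≡-x⇒x≡0 : ∀ {x} → x ≡ - x → x ≡ 0#
    x≡-x⇒x≡0 {x} x≡-x with no-zero-divisors (trans (sym (double x)) (trans (cong (x +_) x≡-x) (-‿inverseʳ x)))
    ... | inj₁ two≡0 = ⊥-elim (two≢0 two≡0)
    ... | inj₂ x≡0 = x≡0
    neg-swap : ∀ {a b} → a ≡ - b → b ≡ - a
    neg-swap {a} {b} a≡-b = trans (sym (neg-involutive b)) (cong -_ (sym a≡-b))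
    five-distinct : Unique (0# ∷ 1# ∷ - 1# ∷ y ∷ - y ∷ [])
    five-distinct =
        (0≢1 ∷ (λ e → -‿nonzero 1≢0 (sym e)) ∷ (λ e → y≢0 (sym e)) ∷ (λ e → -‿nonzero y≢0 (sym e)) ∷ [])
      ∷ ((λ e → 1≢0 (x≡-x⇒x≡0 e)) ∷ (λ e → y≢1 (sym e)) ∷ (λ e → y≢-1 (neg-swap e)) ∷ [])
      ∷ ((λ e → y≢-1 (sym e)) ∷ (λ e → y≢1 (sym (neg-injective e))) ∷ [])
      ∷ ((λ e → y≢0 (x≡-x⇒x≡0 e)) ∷ [])
      ∷ [] ∷ []

  -- In a field with 4 elements squaring is injective (as −b = b), hence
  -- every element is a square.
  square-root : q ≡ 4 → ∀ s → Σ Carrier λ a → a * a ≡ s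
  square-root q≡4 = injective⇒surjective (λ a → a * a) squaring-injective
    where
    b≡-b : ∀ b → b ≡ - b
    b≡-b b = −≡0⇒≡ (trans (l b) (trans (cong (_* b) (characteristic-two q≡4)) (zeroˡ b)))
      where l : ∀ b → b − (- b) ≡ two * b
            l = solve 1 (λ b → b :- (:- b) := (c1 :+ c1) :* b) refl
    squaring-injective : ∀ {a b} → a * a ≡ b * b → a ≡ b
    squaring-injective {a} {b} e with square-roots e
    ... | inj₁ a≡b = a≡b
    ... | inj₂ a≡-b = trans a≡-b (sym (b≡-b b))

  -- For q > 3 some b ≠ 0 has b² ≠ 1 (any b ∉ {0, 1, −1}).
  non-unit-square : 3 < q → Σ Carrier λ b → b ≢ 0# × b * b ≢ 1#
  non-unit-square q>3 with nonzero-avoiding q>3 1# (- 1#)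
  ... | b , b≢0 , b≢1 , b≢-1 = b , b≢0 , b²≢1
    where
    b²≢1 : b * b ≢ 1#
    b²≢1 b²≡1 with square-roots (trans b²≡1 (sym (*-identityʳ 1#)))
    ... | inj₁ b≡1 = b≢1 b≡1
    ... | inj₂ b≡-1 = b≢-1 b≡-1

-- A vector (y, z, t) on the secant through the points with
-- parameters a ≠ b satisfies t − (a + b) z + a b y = 0, and is then a
-- combination of (1, a, a²) and (1, b, b²).
module ConicSecants {q : ℕ} (𝔽 : FiniteField q) where

  open FiniteField 𝔽
  open FiniteFieldFacts 𝔽

  OnSecant : Carrier → Carrier → Carrier → Set
  OnSecant y z t = Σ Carrier λ a → Σ Carrier λ b →
    a ≢ 0# × b ≢ 0# × a ≢ b × t − (a + b) * z + a * b * y ≡ 0#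

  record ConicPairSpan (y z t : Carrier) : Set where
    field
      a b c d : Carrier
      a≢0 : a ≢ 0#
      b≢0 : b ≢ 0#
      first : y ≡ c + d
      second : z ≡ c * a + d * b
      third : t ≡ c * (a * a) + d * (b * b)

  -- Solving the 2 × 2 Vandermonde system in the first two coordinates; the
  -- secant equation then gives the third one.
  secant⇒span : ∀ {y z t} → OnSecant y z t → ConicPairSpan y z t
  secant⇒span {y} {z} {t} (a , b , a≢0 , b≢0 , a≢b , on-line) = record
    { a = a ; b = b ; c = c ; d = d ; a≢0 = a≢0 ; b≢0 = b≢0
    ; first = sym (trans (l₁ a b y z w) (unit y))
    ; second = sym (trans (l₂ a b y z w) (unit z))
    ; third = sym (trans (l₃ a b y z w) (trans (unit _) (sym (trans (l₄ t ((a + b) * z) (a * b * y))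
                (trans (cong (_+ ((a + b) * z − a * b * y)) on-line) (+-identityˡ _))))))
    }
    where
    w = (a − b) ⁻¹
    c = (z − b * y) * w
    d = (a * y − z) * w
    unit : ∀ x → x * ((a − b) * w) ≡ x
    unit x = trans (cong (x *_) (⁻¹-inverseʳ (≢⇒−≢0 a≢b))) (*-identityʳ x)
    l₁ : ∀ a b y z w → (z − b * y) * w + (a * y − z) * w ≡ y * ((a − b) * w)
    l₁ = solve 5 (λ a b y z w → (z :- b :* y) :* w :+ (a :* y :- z) :* w := y :* ((a :- b) :* w)) refl
    l₂ : ∀ a b y z w → (z − b * y) * w * a + (a * y − z) * w * b ≡ z * ((a − b) * w)
    l₂ = solve 5 (λ a b y z w → (z :- b :* y) :* w :* a :+ (a :* y :- z) :* w :* b := z :* ((a :- b) :* w)) refl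
    l₃ : ∀ a b y z w → (z − b * y) * w * (a * a) + (a * y − z) * w * (b * b) ≡ ((a + b) * z − a * b * y) * ((a − b) * w)
    l₃ = solve 5 (λ a b y z w → (z :- b :* y) :* w :* (a :* a) :+ (a :* y :- z) :* w :* (b :* b)
                   := ((a :+ b) :* z :- a :* b :* y) :* ((a :- b) :* w)) refl
    l₄ : ∀ t u v → t ≡ (t − u + v) + (u − v)
    l₄ = solve 3 (λ t u v → t := (t :- u :+ v) :+ (u :- v)) refl

  -- Choosing the first parameter a, the secant equation determines
  -- b = (t − a z)/(z − a y); this b is admissible unless one of the
  -- following expressions vanishes.  Q y z t a = 0 says exactly that b = a.
  Q : Carrier → Carrier → Carrier → Carrier → Carrier
  Q y z t a = y * (a * a) − two * z * a + t

  Admissible : Carrier → Carrier → Carrier → Carrier → Set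
  Admissible y z t a = a ≢ 0# × z − a * y ≢ 0# × t − a * z ≢ 0# × Q y z t a ≢ 0#

  admissible? : ∀ y z t → Decidable (Admissible y z t)
  admissible? y z t a = ¬? (a ≟ 0#) ×-dec ¬? (z − a * y ≟ 0#) ×-dec ¬? (t − a * z ≟ 0#) ×-dec ¬? (Q y z t a ≟ 0#)

  admissible⇒secant : ∀ {y z t a} → Admissible y z t a → OnSecant y z t
  admissible⇒secant {y} {z} {t} {a} (a≢0 , D≢0 , N≢0 , Q≢0) = a , b , a≢0 , *-nonzero N≢0 (⁻¹-nonzero D≢0) , a≢b , on-line
    where
    D = z − a * y
    N = t − a * z
    b = N * D ⁻¹
    a≢b : a ≢ b
    a≢b a≡b = Q≢0 (trans (l y z t a) (trans (cong (λ u → N − u * D) a≡b) (trans (cong (N −_) (⁻¹-cancelʳ N D≢0)) (-‿inverseʳ N))))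
      where l : ∀ y z t a → Q y z t a ≡ (t − a * z) − a * (z − a * y)
            l = solve 4 (λ y z t a → y :* (a :* a) :- (c1 :+ c1) :* z :* a :+ t := (t :- a :* z) :- a :* (z :- a :* y)) refl
    on-line : t − (a + b) * z + a * b * y ≡ 0#
    on-line = trans (l t a z y (D ⁻¹)) (trans (cong (λ u → N * (1# − u)) (⁻¹-inverseˡ D≢0))
                (trans (cong (N *_) (-‿inverseʳ 1#)) (zeroʳ N)))
      where l : ∀ t a z y w → t − (a + (t − a * z) * w) * z + a * ((t − a * z) * w) * y ≡ (t − a * z) * (1# − w * (z − a * y))
            l = solve 5 (λ t a z y w → t :- (a :+ (t :- a :* z) :* w) :* z :+ a :* ((t :- a :* z) :* w) :* y
                          := (t :- a :* z) :* (c1 :- w :* (z :- a :* y))) refl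

  inadmissible : ∀ {y z t} a → ¬ Admissible y z t a →
                 a ≡ 0# ⊎ z − a * y ≡ 0# ⊎ t − a * z ≡ 0# ⊎ Q y z t a ≡ 0#
  inadmissible {y} {z} {t} a fails with a ≟ 0# | z − a * y ≟ 0# | t − a * z ≟ 0#
  ... | yes e | _ | _ = inj₁ e
  ... | no _ | yes e | _ = inj₂ (inj₁ e)
  ... | no _ | no _ | yes e = inj₂ (inj₂ (inj₁ e))
  ... | no ne₁ | no ne₂ | no ne₃ = inj₂ (inj₂ (inj₂ (≢-stable (λ ne₄ → fails (ne₁ , ne₂ , ne₃ , ne₄)))))

  Q-roots : ∀ {y z t} → y ≢ 0# → Σ (List Carrier) λ R → length R ≤ 2 × (∀ a → Q y z t a ≡ 0# → a ∈ R)
  Q-roots {y} {z} {t} y≢0 with search (λ r → Q y z t r ≟ 0#)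
  ... | inj₂ none = [] , z≤n , λ a Qa≡0 → ⊥-elim (none a Qa≡0)
  ... | inj₁ (r , Qr≡0) = r ∷ y ⁻¹ * (two * z) − r ∷ [] , ℕP.≤-refl , other-root
    where
    difference : ∀ y z t a r → Q y z t a − Q y z t r ≡ (a − r) * (y * (a + r) − two * z)
    difference = solve 5 (λ y z t a r →
      (y :* (a :* a) :- (c1 :+ c1) :* z :* a :+ t) :- (y :* (r :* r) :- (c1 :+ c1) :* z :* r :+ t)
        := (a :- r) :* (y :* (a :+ r) :- (c1 :+ c1) :* z)) refl
    move : ∀ a r → a ≡ (a + r) − r
    move = solve 2 (λ a r → a := (a :+ r) :- r) refl
    other-root : ∀ a → Q y z t a ≡ 0# → a ∈ (r ∷ y ⁻¹ * (two * z) − r ∷ [])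
    other-root a Qa≡0
      with no-zero-divisors (trans (sym (difference y z t a r)) (trans (cong₂ _−_ Qa≡0 Qr≡0) (-‿inverseʳ 0#)))
    ... | inj₁ a−r≡0 = here (−≡0⇒≡ a−r≡0)
    ... | inj₂ e = there (here (trans (move a r) (cong (_− r) (solve-linear y≢0 (−≡0⇒≡ e)))))

  secant-avoiding : ∀ {y z t} (bad : List Carrier) → length bad < q →
                    (∀ a → ¬ Admissible y z t a → a ∈ bad) → OnSecant y z t
  secant-avoiding {y} {z} {t} bad short bad∈ with avoid (admissible? y z t) bad short bad∈
  ... | _ , admissible = admissible⇒secant admissible

  secant-y≡0 : 3 < q → ∀ {z t} → z ≢ 0# → t ≢ 0# → OnSecant 0# z t
  secant-y≡0 q>3 {z} {t} z≢0 t≢0 = secant-avoiding (0# ∷ z ⁻¹ * t ∷ (two * z) ⁻¹ * t ∷ []) q>3 bad∈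
    where
    D≡z : ∀ z a → z − a * 0# ≡ z
    D≡z = solve 2 (λ z a → z :- a :* c0 := z) refl
    Q≡ : ∀ z t a → Q 0# z t a ≡ t − (two * z) * a
    Q≡ = solve 3 (λ z t a → c0 :* (a :* a) :- (c1 :+ c1) :* z :* a :+ t := t :- ((c1 :+ c1) :* z) :* a) refl
    bad∈ : ∀ a → ¬ Admissible 0# z t a → a ∈ (0# ∷ z ⁻¹ * t ∷ (two * z) ⁻¹ * t ∷ [])
    bad∈ a fails with inadmissible a fails
    ... | inj₁ a≡0 = here a≡0
    ... | inj₂ (inj₁ D≡0) = ⊥-elim (z≢0 (trans (sym (D≡z z a)) D≡0))
    ... | inj₂ (inj₂ (inj₁ N≡0)) = there (here (solve-linear-nonzero t≢0 (sym (trans (−≡0⇒≡ N≡0) (*-comm a z)))))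
    ... | inj₂ (inj₂ (inj₂ Q≡0)) = there (there (here (solve-linear-nonzero t≢0 (sym (−≡0⇒≡ (trans (sym (Q≡ z t a)) Q≡0))))))

  secant-t≡0 : 3 < q → ∀ {y z} → y ≢ 0# → z ≢ 0# → OnSecant y z 0#
  secant-t≡0 q>3 {y} {z} y≢0 z≢0 = secant-avoiding (0# ∷ y ⁻¹ * z ∷ y ⁻¹ * (two * z) ∷ []) q>3 bad∈
    where
    N≡ : ∀ a z → 0# − a * z ≡ - (a * z)
    N≡ = solve 2 (λ a z → c0 :- a :* z := :- (a :* z)) refl
    Q≡ : ∀ y z a → Q y z 0# a ≡ a * (y * a − two * z)
    Q≡ = solve 3 (λ y z a → y :* (a :* a) :- (c1 :+ c1) :* z :* a :+ c0 := a :* (y :* a :- (c1 :+ c1) :* z)) refl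
    bad∈ : ∀ a → ¬ Admissible y z 0# a → a ∈ (0# ∷ y ⁻¹ * z ∷ y ⁻¹ * (two * z) ∷ [])
    bad∈ a fails with inadmissible a fails
    ... | inj₁ a≡0 = here a≡0
    ... | inj₂ (inj₁ D≡0) = there (here (solve-linearʳ y≢0 (sym (−≡0⇒≡ D≡0))))
    ... | inj₂ (inj₂ (inj₁ N≡0)) with no-zero-divisors (neg-zero (trans (sym (N≡ a z)) N≡0))
    ...   | inj₁ a≡0 = here a≡0
    ...   | inj₂ z≡0 = ⊥-elim (z≢0 z≡0)
    bad∈ a fails | inj₂ (inj₂ (inj₂ Q≡0)) with no-zero-divisors (trans (sym (Q≡ y z a)) Q≡0)
    ...   | inj₁ a≡0 = here a≡0
    ...   | inj₂ e = there (there (here (solve-linear y≢0 (−≡0⇒≡ e))))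

  secant-z≡0 : 3 < q → ∀ {y t} → y ≢ 0# → t ≢ 0# → OnSecant y 0# t
  secant-z≡0 q>3 {y} {t} y≢0 t≢0 with Q-roots {y} {0#} {t} y≢0
  ... | R , |R|≤2 , roots = secant-avoiding (0# ∷ R) (ℕP.≤-trans (s≤s (s≤s |R|≤2)) q>3) bad∈
    where
    D≡ : ∀ a y → 0# − a * y ≡ - (a * y)
    D≡ = solve 2 (λ a y → c0 :- a :* y := :- (a :* y)) refl
    N≡ : ∀ t a → t − a * 0# ≡ t
    N≡ = solve 2 (λ t a → t :- a :* c0 := t) refl
    bad∈ : ∀ a → ¬ Admissible y 0# t a → a ∈ (0# ∷ R)
    bad∈ a fails with inadmissible a fails
    ... | inj₁ a≡0 = here a≡0
    ... | inj₂ (inj₂ (inj₁ N≡0)) = ⊥-elim (t≢0 (trans (sym (N≡ t a)) N≡0))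
    ... | inj₂ (inj₂ (inj₂ Q≡0)) = there (roots a Q≡0)
    ... | inj₂ (inj₁ D≡0) with no-zero-divisors (neg-zero (trans (sym (D≡ a y)) D≡0))
    ...   | inj₁ a≡0 = here a≡0
    ...   | inj₂ y≡0 = ⊥-elim (y≢0 y≡0)

  secant-generic : 5 < q → ∀ {y z t} → y ≢ 0# → z ≢ 0# → t ≢ 0# → OnSecant y z t
  secant-generic q>5 {y} {z} {t} y≢0 z≢0 t≢0 with Q-roots {y} {z} {t} y≢0
  ... | R , |R|≤2 , roots =
    secant-avoiding (0# ∷ y ⁻¹ * z ∷ z ⁻¹ * t ∷ R) (ℕP.≤-trans (s≤s (s≤s (s≤s (s≤s |R|≤2)))) q>5) bad∈
    where
    bad∈ : ∀ a → ¬ Admissible y z t a → a ∈ (0# ∷ y ⁻¹ * z ∷ z ⁻¹ * t ∷ R)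
    bad∈ a fails with inadmissible a fails
    ... | inj₁ a≡0 = here a≡0
    ... | inj₂ (inj₁ D≡0) = there (here (solve-linearʳ y≢0 (sym (−≡0⇒≡ D≡0))))
    ... | inj₂ (inj₂ (inj₁ N≡0)) = there (there (here (solve-linearʳ z≢0 (sym (−≡0⇒≡ N≡0)))))
    ... | inj₂ (inj₂ (inj₂ Q≡0)) = there (there (there (roots a Q≡0)))

module Combinations {q : ℕ} (𝔽 : FiniteField q) where

  open FiniteField 𝔽
  open FiniteFieldFacts 𝔽
  open PG5 𝔽 public

  vec : Carrier → Carrier → Carrier → Carrier → Carrier → Carrier → V
  vec x₀ x₁ x₂ x₃ x₄ x₅ zero = x₀
  vec x₀ x₁ x₂ x₃ x₄ x₅ (suc zero) = x₁
  vec x₀ x₁ x₂ x₃ x₄ x₅ (suc (suc zero)) = x₂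
  vec x₀ x₁ x₂ x₃ x₄ x₅ (suc (suc (suc zero))) = x₃
  vec x₀ x₁ x₂ x₃ x₄ x₅ (suc (suc (suc (suc zero)))) = x₄
  vec x₀ x₁ x₂ x₃ x₄ x₅ (suc (suc (suc (suc (suc zero))))) = x₅

  coordinatewise : ∀ {v w : V} → v ℓ₀ ≡ w ℓ₀ → v ℓ₁ ≡ w ℓ₁ → v ℓ₂ ≡ w ℓ₂ →
                   v ℓ₃ ≡ w ℓ₃ → v ℓ₄ ≡ w ℓ₄ → v ℓ₅ ≡ w ℓ₅ → v ≗ w
  coordinatewise e₀ e₁ e₂ e₃ e₄ e₅ zero = e₀
  coordinatewise e₀ e₁ e₂ e₃ e₄ e₅ (suc zero) = e₁
  coordinatewise e₀ e₁ e₂ e₃ e₄ e₅ (suc (suc zero)) = e₂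
  coordinatewise e₀ e₁ e₂ e₃ e₄ e₅ (suc (suc (suc zero))) = e₃
  coordinatewise e₀ e₁ e₂ e₃ e₄ e₅ (suc (suc (suc (suc zero)))) = e₄
  coordinatewise e₀ e₁ e₂ e₃ e₄ e₅ (suc (suc (suc (suc (suc zero))))) = e₅

  vec-η : ∀ x → x ≗ vec (x ℓ₀) (x ℓ₁) (x ℓ₂) (x ℓ₃) (x ℓ₄) (x ℓ₅)
  vec-η x = coordinatewise refl refl refl refl refl refl

  ≗-trans : ∀ {u v w : V} → u ≗ v → v ≗ w → u ≗ w
  ≗-trans u≗v v≗w i = trans (u≗v i) (v≗w i)

  record Combination (n : ℕ) (X : PointSet) (v : V) : Set where
    constructor combination
    field
      points : Fin n → V
      points∈X : ∀ i → X (points i)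
      coefficients : Fin n → Carrier
      expansion : v ≗ lincomb n coefficients points

  covered : ∀ {n ρ X v} → n ≤ suc ρ → Combination n X v → Covered ρ X v
  covered {n} n≤ρ+1 (combination p p∈X c v≗) = n , n≤ρ+1 , p , p∈X , c , v≗

  combination-resp : ∀ {n X v w} → v ≗ w → Combination n X w → Combination n X v
  combination-resp v≗w (combination p p∈X c w≗) = combination p p∈X c (≗-trans v≗w w≗)

  combination-mono : ∀ {n X Y v} → (∀ w → X w → Y w) → Combination n X v → Combination n Y v
  combination-mono X⊆Y (combination p p∈X c v≗) = combination p (λ i → X⊆Y (p i) (p∈X i)) c v≗

  combination-zero : ∀ {X} → Combination 0 X zeroV
  combination-zero = combination (λ ()) (λ ()) (λ ()) (λ _ → refl)

  combination-cons : ∀ {n X p w} c → X p → Combination n X w → Combination (suc n) X ((c · p) +V w)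
  combination-cons {n} {X} {p} {w} c p∈X (combination ps ps∈X cs w≗) = combination p′ p′∈X c′ λ i → cong (c * p i +_) (w≗ i)
    where
    p′ : Fin (suc n) → V
    p′ zero = p
    p′ (suc i) = ps i
    p′∈X : ∀ i → X (p′ i)
    p′∈X zero = p∈X
    p′∈X (suc i) = ps∈X i
    c′ : Fin (suc n) → Carrier
    c′ zero = c
    c′ (suc i) = cs i

  combination-one : ∀ {X p v} c → X p → v ≗ c · p → Combination 1 X v
  combination-one {X} c p∈X v≗cp =
    combination-resp {X = X} (λ i → trans (v≗cp i) (sym (+-identityʳ _))) (combination-cons {X = X} c p∈X (combination-zero {X = X}))

  drop-first : ∀ {k X} (p : Fin (suc k) → V) → (∀ i → X (p i)) → (c : Fin (suc k) → Carrier) →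
               Combination k X (lincomb k (λ j → c (suc j)) (λ j → p (suc j)))
  drop-first p p∈X c = combination (λ j → p (suc j)) (λ j → p∈X (suc j)) (λ j → c (suc j)) (λ _ → refl)

  combination-+ : ∀ {m n X u w} → Combination m X u → Combination n X w → Combination (m ℕ.+ n) X (u +V w)
  combination-+ {zero} {X = X} (combination _ _ _ u≗) comb =
    combination-resp {X = X} (λ i → trans (cong (_+ _) (u≗ i)) (+-identityˡ _)) comb
  combination-+ {suc m} {X = X} {w = w} (combination p p∈X c u≗) comb =
    combination-resp {X = X} (λ i → trans (cong (_+ w i) (u≗ i)) (+-assoc _ _ _))
      (combination-cons {X = X} (c zero) (p∈X zero)
        (combination-+ {m} {X = X} (drop-first p p∈X c) comb))

  combine : ∀ {m n X a₀ a₁ a₂ a₃ a₄ a₅ b₀ b₁ b₂ b₃ b₄ b₅ x₀ x₁ x₂ x₃ x₄ x₅} →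
            Combination m X (vec a₀ a₁ a₂ a₃ a₄ a₅) → Combination n X (vec b₀ b₁ b₂ b₃ b₄ b₅) →
            x₀ ≡ a₀ + b₀ → x₁ ≡ a₁ + b₁ → x₂ ≡ a₂ + b₂ → x₃ ≡ a₃ + b₃ → x₄ ≡ a₄ + b₄ → x₅ ≡ a₅ + b₅ →
            Combination (m ℕ.+ n) X (vec x₀ x₁ x₂ x₃ x₄ x₅)
  combine {X = X} comb₁ comb₂ e₀ e₁ e₂ e₃ e₄ e₅ =
    combination-resp {X = X} (coordinatewise e₀ e₁ e₂ e₃ e₄ e₅) (combination-+ {X = X} comb₁ comb₂)

  x≡x+0 : ∀ x → x ≡ x + 0#
  x≡x+0 x = sym (+-identityʳ x)

  x≡0+x : ∀ x → x ≡ 0# + x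
  x≡0+x x = sym (+-identityˡ x)

  0≡0+0 : 0# ≡ 0# + 0#
  0≡0+0 = x≡0+x 0#

  -- The seven families of points of S₂, as in its definition:
  -- A = e₀, B a = e₀ + a e₁, C a = e₁ + a e₂ + a² e₃, D = e₂,
  -- E a = e₃ + a e₄ + a² e₅, F = e₄, G = e₅ (with a ≠ 0 in B, C, E).
  Pa Pd Pf Pg : V
  Pa = e ℓ₀
  Pd = e ℓ₂
  Pf = e ℓ₄
  Pg = e ℓ₅

  Pb Pc Pe : Carrier → V
  Pb a = e ℓ₀ +V (a · e ℓ₁)
  Pc a = e ℓ₁ +V ((a · e ℓ₂) +V ((a * a) · e ℓ₃))
  Pe a = e ℓ₃ +V ((a · e ℓ₄) +V ((a * a) · e ℓ₅))

  S₂-a : S₂ Pa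
  S₂-a = inj₁ (λ _ → refl)
  S₂-b : ∀ {a} → a ≢ 0# → S₂ (Pb a)
  S₂-b {a} a≢0 = inj₂ (inj₁ (a , a≢0 , λ _ → refl))
  S₂-c : ∀ {a} → a ≢ 0# → S₂ (Pc a)
  S₂-c {a} a≢0 = inj₂ (inj₂ (inj₁ (a , a≢0 , λ _ → refl)))
  S₂-d : S₂ Pd
  S₂-d = inj₂ (inj₂ (inj₂ (inj₁ (λ _ → refl))))
  S₂-e : ∀ {a} → a ≢ 0# → S₂ (Pe a)
  S₂-e {a} a≢0 = inj₂ (inj₂ (inj₂ (inj₂ (inj₁ (a , a≢0 , λ _ → refl)))))
  S₂-f : S₂ Pf
  S₂-f = inj₂ (inj₂ (inj₂ (inj₂ (inj₂ (inj₁ (λ _ → refl))))))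
  S₂-g : S₂ Pg
  S₂-g = inj₂ (inj₂ (inj₂ (inj₂ (inj₂ (inj₂ (λ _ → refl))))))

  Pa-vec : Pa ≗ vec 1# 0# 0# 0# 0# 0#
  Pa-vec = coordinatewise refl refl refl refl refl refl
  Pd-vec : Pd ≗ vec 0# 0# 1# 0# 0# 0#
  Pd-vec = coordinatewise refl refl refl refl refl refl
  Pf-vec : Pf ≗ vec 0# 0# 0# 0# 1# 0#
  Pf-vec = coordinatewise refl refl refl refl refl refl
  Pg-vec : Pg ≗ vec 0# 0# 0# 0# 0# 1#
  Pg-vec = coordinatewise refl refl refl refl refl refl

  private
    l-1 : ∀ a → 1# + a * 0# ≡ 1#
    l-1 = solve 1 (λ a → c1 :+ a :* c0 := c1) refl
    l-a : ∀ a → 0# + a * 1# ≡ a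
    l-a = solve 1 (λ a → c0 :+ a :* c1 := a) refl
    l-0 : ∀ a → 0# + a * 0# ≡ 0#
    l-0 = solve 1 (λ a → c0 :+ a :* c0 := c0) refl
    m-1 : ∀ a → 1# + (a * 0# + (a * a) * 0#) ≡ 1#
    m-1 = solve 1 (λ a → c1 :+ (a :* c0 :+ (a :* a) :* c0) := c1) refl
    m-a : ∀ a → 0# + (a * 1# + (a * a) * 0#) ≡ a
    m-a = solve 1 (λ a → c0 :+ (a :* c1 :+ (a :* a) :* c0) := a) refl
    m-aa : ∀ a → 0# + (a * 0# + (a * a) * 1#) ≡ a * a
    m-aa = solve 1 (λ a → c0 :+ (a :* c0 :+ (a :* a) :* c1) := a :* a) refl
    m-0 : ∀ a → 0# + (a * 0# + (a * a) * 0#) ≡ 0#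
    m-0 = solve 1 (λ a → c0 :+ (a :* c0 :+ (a :* a) :* c0) := c0) refl

  Pb-vec : ∀ a → Pb a ≗ vec 1# a 0# 0# 0# 0#
  Pb-vec a = coordinatewise (l-1 a) (l-a a) (l-0 a) (l-0 a) (l-0 a) (l-0 a)
  Pc-vec : ∀ a → Pc a ≗ vec 0# 1# a (a * a) 0# 0#
  Pc-vec a = coordinatewise (m-0 a) (m-1 a) (m-a a) (m-aa a) (m-0 a) (m-0 a)
  Pe-vec : ∀ a → Pe a ≗ vec 0# 0# 0# 1# a (a * a)
  Pe-vec a = coordinatewise (m-0 a) (m-0 a) (m-0 a) (m-1 a) (m-a a) (m-aa a)

  not-proportional : ∀ {p w : V} i → w i ≡ 0# → p i ≢ 0# → ¬ Proportional p w
  not-proportional {p} {w} i wᵢ≡0 pᵢ≢0 (c , _ , p≗cw) = pᵢ≢0 (trans (p≗cw i) (trans (cong (c *_) wᵢ≡0) (zeroʳ c)))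

  SG : PointSet
  SG = S₂ ∖ₚ e ℓ₅

  SG⊆S₂ : ∀ w → SG w → S₂ w
  SG⊆S₂ _ = proj₁

  SG-a : SG Pa
  SG-a = S₂-a , not-proportional ℓ₀ refl 1≢0
  SG-b : ∀ {a} → a ≢ 0# → SG (Pb a)
  SG-b {a} a≢0 = S₂-b a≢0 , not-proportional ℓ₀ refl (λ e → 1≢0 (trans (sym (Pb-vec a ℓ₀)) e))
  SG-c : ∀ {a} → a ≢ 0# → SG (Pc a)
  SG-c {a} a≢0 = S₂-c a≢0 , not-proportional ℓ₁ refl (λ e → 1≢0 (trans (sym (Pc-vec a ℓ₁)) e))
  SG-d : SG Pd
  SG-d = S₂-d , not-proportional ℓ₂ refl 1≢0
  SG-e : ∀ {a} → a ≢ 0# → SG (Pe a)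
  SG-e {a} a≢0 = S₂-e a≢0 , not-proportional ℓ₃ refl (λ e → 1≢0 (trans (sym (Pe-vec a ℓ₃)) e))
  SG-f : SG Pf
  SG-f = S₂-f , not-proportional ℓ₄ refl 1≢0

  scaled : ∀ c {p x₀ x₁ x₂ x₃ x₄ x₅} → p ≗ vec x₀ x₁ x₂ x₃ x₄ x₅ →
           c · p ≗ vec (c * x₀) (c * x₁) (c * x₂) (c * x₃) (c * x₄) (c * x₅)
  scaled c p≗ = coordinatewise (cong (c *_) (p≗ ℓ₀)) (cong (c *_) (p≗ ℓ₁)) (cong (c *_) (p≗ ℓ₂))
                               (cong (c *_) (p≗ ℓ₃)) (cong (c *_) (p≗ ℓ₄)) (cong (c *_) (p≗ ℓ₅))

  multiple : ∀ {X p} c {x₀ x₁ x₂ x₃ x₄ x₅ y₀ y₁ y₂ y₃ y₄ y₅} → X p → p ≗ vec x₀ x₁ x₂ x₃ x₄ x₅ →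
             y₀ ≡ c * x₀ → y₁ ≡ c * x₁ → y₂ ≡ c * x₂ → y₃ ≡ c * x₃ → y₄ ≡ c * x₄ → y₅ ≡ c * x₅ →
             Combination 1 X (vec y₀ y₁ y₂ y₃ y₄ y₅)
  multiple {X} c p∈X p≗ e₀ e₁ e₂ e₃ e₄ e₅ =
    combination-one {X = X} c p∈X (≗-trans (coordinatewise e₀ e₁ e₂ e₃ e₄ e₅) (λ i → sym (scaled c p≗ i)))

  private
    0≡c*0 : ∀ c → 0# ≡ c * 0#
    0≡c*0 c = sym (zeroʳ c)
    c≡c*1 : ∀ c → c ≡ c * 1#
    c≡c*1 c = sym (*-identityʳ c)

  one-a : ∀ {X} c → X Pa → Combination 1 X (vec c 0# 0# 0# 0# 0#)
  one-a {X} c m = multiple {X = X} c m Pa-vec (c≡c*1 c) (0≡c*0 c) (0≡c*0 c) (0≡c*0 c) (0≡c*0 c) (0≡c*0 c)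
  one-b : ∀ {X a} c → X (Pb a) → Combination 1 X (vec c (c * a) 0# 0# 0# 0#)
  one-b {X} {a = a} c m = multiple {X = X} c m (Pb-vec a) (c≡c*1 c) refl (0≡c*0 c) (0≡c*0 c) (0≡c*0 c) (0≡c*0 c)
  one-c : ∀ {X a} c → X (Pc a) → Combination 1 X (vec 0# c (c * a) (c * (a * a)) 0# 0#)
  one-c {X} {a = a} c m = multiple {X = X} c m (Pc-vec a) (0≡c*0 c) (c≡c*1 c) refl refl (0≡c*0 c) (0≡c*0 c)
  one-d : ∀ {X} c → X Pd → Combination 1 X (vec 0# 0# c 0# 0# 0#)
  one-d {X} c m = multiple {X = X} c m Pd-vec (0≡c*0 c) (0≡c*0 c) (c≡c*1 c) (0≡c*0 c) (0≡c*0 c) (0≡c*0 c)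
  one-e : ∀ {X a} c → X (Pe a) → Combination 1 X (vec 0# 0# 0# c (c * a) (c * (a * a)))
  one-e {X} {a = a} c m = multiple {X = X} c m (Pe-vec a) (0≡c*0 c) (0≡c*0 c) (0≡c*0 c) (c≡c*1 c) refl refl
  one-f : ∀ {X} c → X Pf → Combination 1 X (vec 0# 0# 0# 0# c 0#)
  one-f {X} c m = multiple {X = X} c m Pf-vec (0≡c*0 c) (0≡c*0 c) (0≡c*0 c) (0≡c*0 c) (c≡c*1 c) (0≡c*0 c)
  one-g : ∀ {X} c → X Pg → Combination 1 X (vec 0# 0# 0# 0# 0# c)
  one-g {X} c m = multiple {X = X} c m Pg-vec (0≡c*0 c) (0≡c*0 c) (0≡c*0 c) (0≡c*0 c) (0≡c*0 c) (c≡c*1 c)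

module Covering {q : ℕ} (𝔽 : FiniteField q) where

  open FiniteField 𝔽
  open FiniteFieldFacts 𝔽
  open ConicSecants 𝔽
  open Combinations 𝔽

  GoodOrder : Set
  GoodOrder = q ≡ 4 ⊎ 7 ≤ q

  3<q : GoodOrder → 3 < q
  3<q (inj₁ q≡4) = subst (3 <_) (sym q≡4) (ℕP.n<1+n 3)
  3<q (inj₂ 7≤q) = ℕP.≤-trans (s≤s (s≤s (s≤s (s≤s z≤n)))) 7≤q

  5<q : 7 ≤ q → 5 < q
  5<q 7≤q = ℕP.≤-trans (ℕP.n≤1+n 6) 7≤q

  -- The line ⟨e₀, e₁⟩ is spanned by A and B 1; a single point of A ∪ B
  -- suffices unless x₀ = 0 ≠ x₁.
  LineCovered : Carrier → Carrier → Set
  LineCovered x₀ x₁ = x₀ ≢ 0# ⊎ x₁ ≡ 0#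

  line-two : ∀ x₀ x₁ → Combination 2 SG (vec x₀ x₁ 0# 0# 0# 0#)
  line-two x₀ x₁ = combine (one-a (x₀ − x₁) SG-a) (one-b x₁ (SG-b 1≢0))
    (l₀ x₀ x₁) (trans (sym (*-identityʳ x₁)) (x≡0+x _)) 0≡0+0 0≡0+0 0≡0+0 0≡0+0
    where l₀ : ∀ a b → a ≡ (a − b) + b
          l₀ = solve 2 (λ a b → a := (a :- b) :+ b) refl

  line-one : ∀ {x₀ x₁} → LineCovered x₀ x₁ → Combination 1 SG (vec x₀ x₁ 0# 0# 0# 0#)
  line-one {x₀} {x₁} (inj₂ x₁≡0) =
    multiple x₀ SG-a Pa-vec (sym (*-identityʳ x₀)) (trans x₁≡0 (sym (zeroʳ x₀))) z z z z
    where z = sym (zeroʳ x₀)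
  line-one {x₀} {x₁} (inj₁ x₀≢0) with x₁ ≟ 0#
  ... | yes x₁≡0 = line-one (inj₂ x₁≡0)
  ... | no x₁≢0 = multiple x₀ (SG-b (*-nonzero x₁≢0 (⁻¹-nonzero x₀≢0))) (Pb-vec _)
          (sym (*-identityʳ x₀)) (sym (trans (*-comm x₀ _) (⁻¹-cancelʳ x₁ x₀≢0))) z z z z
    where z = sym (zeroʳ x₀)

  line-covered? : ∀ x₀ x₁ → LineCovered x₀ x₁ ⊎ (x₀ ≡ 0# × x₁ ≢ 0#)
  line-covered? x₀ x₁ with x₀ ≟ 0# | x₁ ≟ 0#
  ... | no x₀≢0 | _ = inj₁ (inj₁ x₀≢0)
  ... | yes _ | yes x₁≡0 = inj₁ (inj₂ x₁≡0)
  ... | yes x₀≡0 | no x₁≢0 = inj₂ (x₀≡0 , x₁≢0)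

  ¬exception⇒line-covered : ∀ {x₀ x₁} → ¬ (x₀ ≡ 0# × x₁ ≢ 0#) → LineCovered x₀ x₁
  ¬exception⇒line-covered {x₀} {x₁} ¬exc with line-covered? x₀ x₁
  ... | inj₁ ok = ok
  ... | inj₂ exc = ⊥-elim (¬exc exc)

  conic₁-secant : ∀ {y z t} → OnSecant y z t → Combination 2 SG (vec 0# y z t 0# 0#)
  conic₁-secant on = combine (one-c c (SG-c a≢0)) (one-c d (SG-c b≢0)) 0≡0+0 first second third 0≡0+0 0≡0+0
    where open ConicPairSpan (secant⇒span on)

  conic₂-secant : ∀ {y z t} → OnSecant y z t → Combination 2 SG (vec 0# 0# 0# y z t)
  conic₂-secant on = combine (one-e c (SG-e a≢0)) (one-e d (SG-e b≢0)) 0≡0+0 0≡0+0 0≡0+0 first second third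
    where open ConicPairSpan (secant⇒span on)

  -- For q = 4 every t/y is a square a²; then (y, z, t) = y (1, a, a²) + (z − y a) (0, 1, 0).
  square-parameter : q ≡ 4 → ∀ {y t} → y ≢ 0# → t ≢ 0# → Σ Carrier λ a → a ≢ 0# × y * (a * a) ≡ t
  square-parameter q≡4 {y} {t} y≢0 t≢0 with square-root q≡4 (t * y ⁻¹)
  ... | a , a²≡t/y = a , a≢0 , trans (cong (y *_) a²≡t/y) (trans (*-comm y _) (⁻¹-cancelʳ t y≢0))
    where a≢0 : a ≢ 0#
          a≢0 a≡0 = *-nonzero t≢0 (⁻¹-nonzero y≢0) (trans (sym a²≡t/y) (trans (cong (_* a) a≡0) (zeroˡ a)))

  private
    z-split : ∀ y a z → z ≡ y * a + (z − y * a)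
    z-split = solve 3 (λ y a z → z := y :* a :+ (z :- y :* a)) refl

  -- If all three coordinates are nonzero: a generic secant for q ≥ 7, and
  -- the square-root construction above for q = 4.

  conic₁-all-nonzero : GoodOrder → ∀ {y z t} → y ≢ 0# → z ≢ 0# → t ≢ 0# → Combination 2 SG (vec 0# y z t 0# 0#)
  conic₁-all-nonzero (inj₂ 7≤q) y≢0 z≢0 t≢0 = conic₁-secant (secant-generic (5<q 7≤q) y≢0 z≢0 t≢0)
  conic₁-all-nonzero (inj₁ q≡4) {y} {z} {t} y≢0 _ t≢0 = via-square (square-parameter q≡4 y≢0 t≢0)
    where
    via-square : (Σ Carrier λ a → a ≢ 0# × y * (a * a) ≡ t) → Combination 2 SG (vec 0# y z t 0# 0#)
    via-square (a , a≢0 , ya²≡t) = combine (one-c y (SG-c a≢0)) (one-d (z − y * a) SG-d)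
      0≡0+0 (x≡x+0 y) (z-split y a z) (trans (sym ya²≡t) (x≡x+0 _)) 0≡0+0 0≡0+0

  conic₂-all-nonzero : GoodOrder → ∀ {y z t} → y ≢ 0# → z ≢ 0# → t ≢ 0# → Combination 2 SG (vec 0# 0# 0# y z t)
  conic₂-all-nonzero (inj₂ 7≤q) y≢0 z≢0 t≢0 = conic₂-secant (secant-generic (5<q 7≤q) y≢0 z≢0 t≢0)
  conic₂-all-nonzero (inj₁ q≡4) {y} {z} {t} y≢0 _ t≢0 = via-square (square-parameter q≡4 y≢0 t≢0)
    where
    via-square : (Σ Carrier λ a → a ≢ 0# × y * (a * a) ≡ t) → Combination 2 SG (vec 0# 0# 0# y z t)
    via-square (a , a≢0 , ya²≡t) = combine (one-e y (SG-e a≢0)) (one-f (z − y * a) SG-f)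
      0≡0+0 0≡0+0 0≡0+0 (x≡x+0 y) (z-split y a z) (trans (sym ya²≡t) (x≡x+0 _))

  -- With b ≠ 0, b² ≠ 1 and u = t/(1 − b²):  u C 1 − u C b + (b − 1) u D = t e₃,
  -- and likewise with E, F for t e₅.
  AxisParameter : Carrier → Set
  AxisParameter t = Σ Carrier λ b → b ≢ 0# × Σ Carrier λ u → u * (1# * 1#) + (- u * (b * b) + 0#) ≡ t

  axis-parameter : GoodOrder → ∀ t → AxisParameter t
  axis-parameter good t = scale (non-unit-square (3<q good))
    where
    l : ∀ t w b → (t * w) * (1# * 1#) + (- (t * w) * (b * b) + 0#) ≡ t * (w * (1# − b * b))
    l = solve 3 (λ t w b → (t :* w) :* (c1 :* c1) :+ (:- (t :* w) :* (b :* b) :+ c0) := t :* (w :* (c1 :- b :* b))) refl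
    scale : (Σ Carrier λ b → b ≢ 0# × b * b ≢ 1#) → AxisParameter t
    scale (b , b≢0 , b²≢1) = b , b≢0 , t * w ,
      trans (l t w b) (trans (cong (t *_) (⁻¹-inverseˡ (≢⇒−≢0 (λ e → b²≢1 (sym e))))) (*-identityʳ t))
      where w = (1# − b * b) ⁻¹

  private
    0≡0+0+0 : 0# ≡ 0# + (0# + 0#)
    0≡0+0+0 = trans 0≡0+0 (cong (0# +_) 0≡0+0)
    cancel₁ : ∀ u → 0# ≡ u + (- u + 0#)
    cancel₁ = solve 1 (λ u → c0 := u :+ (:- u :+ c0)) refl
    cancel₂ : ∀ u b → 0# ≡ u * 1# + (- u * b + (b − 1#) * u)
    cancel₂ = solve 2 (λ u b → c0 := u :* c1 :+ (:- u :* b :+ (b :- c1) :* u)) refl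

  axis₃ : GoodOrder → ∀ t → Combination 3 SG (vec 0# 0# 0# t 0# 0#)
  axis₃ good t = from-parameter (axis-parameter good t)
    where
    from-parameter : AxisParameter t → Combination 3 SG (vec 0# 0# 0# t 0# 0#)
    from-parameter (b , b≢0 , u , u-eq) = combine (one-c u (SG-c 1≢0))
      (combine (one-c (- u) (SG-c b≢0)) (one-d ((b − 1#) * u) SG-d) refl refl refl refl refl refl)
      0≡0+0+0 (cancel₁ u) (cancel₂ u b) (sym u-eq) 0≡0+0+0 0≡0+0+0

  axis₅ : GoodOrder → ∀ t → Combination 3 SG (vec 0# 0# 0# 0# 0# t)
  axis₅ good t = from-parameter (axis-parameter good t)
    where
    from-parameter : AxisParameter t → Combination 3 SG (vec 0# 0# 0# 0# 0# t)
    from-parameter (b , b≢0 , u , u-eq) = combine (one-e u (SG-e 1≢0))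
      (combine (one-e (- u) (SG-e b≢0)) (one-f ((b − 1#) * u) SG-f) refl refl refl refl refl refl)
      0≡0+0+0 0≡0+0+0 0≡0+0+0 (cancel₁ u) (cancel₂ u b) (sym u-eq)

  NotM₁ : Carrier → Carrier → Carrier → Carrier → Set
  NotM₁ x₀ x₁ x₂ x₃ = x₂ ≢ 0# ⊎ x₃ ≡ 0# ⊎ (x₀ ≡ 0# × x₁ ≢ 0#)

  M₁? : ∀ x₀ x₁ x₂ x₃ → M₁ x₀ x₁ x₂ x₃ ⊎ NotM₁ x₀ x₁ x₂ x₃
  M₁? x₀ x₁ x₂ x₃ with x₂ ≟ 0# | x₃ ≟ 0# | line-covered? x₀ x₁
  ... | no x₂≢0 | _ | _ = inj₂ (inj₁ x₂≢0)
  ... | yes _ | yes x₃≡0 | _ = inj₂ (inj₂ (inj₁ x₃≡0))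
  ... | yes _ | no _ | inj₂ exception = inj₂ (inj₂ (inj₂ exception))
  ... | yes x₂≡0 | no x₃≢0 | inj₁ (inj₁ x₀≢0) = inj₁ (x₂≡0 , x₃≢0 , λ (x₀≡0 , _) → x₀≢0 x₀≡0)
  ... | yes x₂≡0 | no x₃≢0 | inj₁ (inj₂ x₁≡0) = inj₁ (x₂≡0 , x₃≢0 , λ (_ , x₁≢0) → x₁≢0 x₁≡0)

  NotM₁⇒¬M₁ : ∀ {x₀ x₁ x₂ x₃} → NotM₁ x₀ x₁ x₂ x₃ → ¬ M₁ x₀ x₁ x₂ x₃
  NotM₁⇒¬M₁ (inj₁ x₂≢0) (x₂≡0 , _ , _) = x₂≢0 x₂≡0
  NotM₁⇒¬M₁ (inj₂ (inj₁ x₃≡0)) (_ , x₃≢0 , _) = x₃≢0 x₃≡0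
  NotM₁⇒¬M₁ (inj₂ (inj₂ exception)) (_ , _ , ¬exception) = ¬exception exception

  ¬M₁⇒NotM₁ : ∀ {x₀ x₁ x₂ x₃} → ¬ M₁ x₀ x₁ x₂ x₃ → NotM₁ x₀ x₁ x₂ x₃
  ¬M₁⇒NotM₁ {x₀} {x₁} {x₂} {x₃} ¬m with M₁? x₀ x₁ x₂ x₃
  ... | inj₁ m = ⊥-elim (¬m m)
  ... | inj₂ n = n

  -- (y₂, y₃) with y₂, y₃ ≠ 0 equals c (a, a²) for a = y₃/y₂, c = y₂/a
  ConicMultiple : Carrier → Carrier → Set
  ConicMultiple y₂ y₃ = Σ Carrier λ a → Σ Carrier λ c → a ≢ 0# × c * a ≡ y₂ × c * (a * a) ≡ y₃

  conic-multiple : ∀ {y₂ y₃} → y₂ ≢ 0# → y₃ ≢ 0# → ConicMultiple y₂ y₃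
  conic-multiple {y₂} {y₃} y₂≢0 y₃≢0 =
    a , c , a≢0 , ca≡y₂ , trans (l c a) (trans (cong (_* a) ca≡y₂) (trans (*-comm y₂ a) (⁻¹-cancelʳ y₃ y₂≢0)))
    where
    a = y₃ * y₂ ⁻¹
    a≢0 = *-nonzero y₃≢0 (⁻¹-nonzero y₂≢0)
    c = y₂ * a ⁻¹
    ca≡y₂ : c * a ≡ y₂
    ca≡y₂ = ⁻¹-cancelʳ y₂ a≢0
    l : ∀ c a → c * (a * a) ≡ (c * a) * a
    l = solve 2 (λ c a → c :* (a :* a) := (c :* a) :* a) refl

  solid-two : GoodOrder → ∀ y₀ y₁ y₂ y₃ → NotM₁ y₀ y₁ y₂ y₃ → Combination 2 SG (vec y₀ y₁ y₂ y₃ 0# 0#)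
  solid-two good y₀ y₁ y₂ y₃ notM₁ with y₂ ≟ 0# | y₃ ≟ 0#
  ... | yes y₂≡0 | yes y₃≡0 = combination-resp (coordinatewise refl refl y₂≡0 y₃≡0 refl refl) (line-two y₀ y₁)
  ... | no y₂≢0 | yes y₃≡0 = plane₀₁₂ (line-covered? y₀ y₁)
    where
    plane₀₁₂ : LineCovered y₀ y₁ ⊎ (y₀ ≡ 0# × y₁ ≢ 0#) → Combination 2 SG (vec y₀ y₁ y₂ y₃ 0# 0#)
    plane₀₁₂ (inj₁ ok) = combine (line-one ok) (one-d y₂ SG-d) (x≡x+0 y₀) (x≡x+0 y₁) (x≡0+x y₂) (trans y₃≡0 0≡0+0) 0≡0+0 0≡0+0
    plane₀₁₂ (inj₂ (y₀≡0 , y₁≢0)) = combination-resp (coordinatewise y₀≡0 refl refl y₃≡0 refl refl)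
      (conic₁-secant (secant-t≡0 (3<q good) y₁≢0 y₂≢0))
  ... | yes y₂≡0 | no y₃≢0 = on-conic notM₁
    where
    on-conic : NotM₁ y₀ y₁ y₂ y₃ → Combination 2 SG (vec y₀ y₁ y₂ y₃ 0# 0#)
    on-conic (inj₁ y₂≢0) = ⊥-elim (y₂≢0 y₂≡0)
    on-conic (inj₂ (inj₁ y₃≡0)) = ⊥-elim (y₃≢0 y₃≡0)
    on-conic (inj₂ (inj₂ (y₀≡0 , y₁≢0))) = combination-resp (coordinatewise y₀≡0 refl y₂≡0 refl refl refl)
      (conic₁-secant (secant-z≡0 (3<q good) y₁≢0 y₃≢0))
  ... | no y₂≢0 | no y₃≢0 = generic (line-covered? y₀ y₁)
    where
    through-point : y₀ ≢ 0# → ConicMultiple y₂ y₃ → Combination 2 SG (vec y₀ y₁ y₂ y₃ 0# 0#)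
    through-point y₀≢0 (a , c , a≢0 , ca≡y₂ , ca²≡y₃) = combine (one-c c (SG-c a≢0)) (line-one {y₀} {y₁ − c} (inj₁ y₀≢0))
      (x≡0+x y₀) (l c y₁) (trans (sym ca≡y₂) (x≡x+0 _)) (trans (sym ca²≡y₃) (x≡x+0 _)) 0≡0+0 0≡0+0
      where l : ∀ c y → y ≡ c + (y − c)
            l = solve 2 (λ c y → y := c :+ (y :- c)) refl
    generic : LineCovered y₀ y₁ ⊎ (y₀ ≡ 0# × y₁ ≢ 0#) → Combination 2 SG (vec y₀ y₁ y₂ y₃ 0# 0#)
    generic (inj₂ (y₀≡0 , y₁≢0)) = combination-resp (coordinatewise y₀≡0 refl refl refl refl refl)
      (conic₁-all-nonzero good y₁≢0 y₂≢0 y₃≢0)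
    generic (inj₁ (inj₁ y₀≢0)) = through-point y₀≢0 (conic-multiple y₂≢0 y₃≢0)
    generic (inj₁ (inj₂ y₁≡0)) with y₀ ≟ 0#
    ... | no y₀≢0 = through-point y₀≢0 (conic-multiple y₂≢0 y₃≢0)
    ... | yes y₀≡0 = combination-resp (coordinatewise y₀≡0 y₁≡0 refl refl refl refl)
      (conic₁-secant (secant-y≡0 (3<q good) y₂≢0 y₃≢0))

  with-line : ∀ {x₀ x₁ x₂ x₃ x₄ x₅} → x₂ ≡ 0# → LineCovered x₀ x₁ →
              Combination 2 SG (vec 0# 0# 0# x₃ x₄ x₅) → Covered 2 SG (vec x₀ x₁ x₂ x₃ x₄ x₅)
  with-line {x₀} {x₁} {x₂} {x₃} {x₄} {x₅} x₂≡0 ok comb = covered ℕP.≤-refl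
    (combine comb (line-one ok) (x≡0+x x₀) (x≡0+x x₁) (trans x₂≡0 0≡0+0) (x≡x+0 x₃) (x≡x+0 x₄) (x≡x+0 x₅))

  covered-resp : ∀ {ρ X v w} → v ≗ w → Covered ρ X w → Covered ρ X v
  covered-resp v≗w (n , n≤ρ+1 , p , p∈X , c , w≗) = n , n≤ρ+1 , p , p∈X , c , ≗-trans v≗w w≗

  case-solid : GoodOrder → ∀ x₀ x₁ x₂ x₃ → Covered 2 SG (vec x₀ x₁ x₂ x₃ 0# 0#)
  case-solid good x₀ x₁ x₂ x₃ with M₁? x₀ x₁ x₂ x₃
  ... | inj₂ notM₁ = covered (ℕP.n≤1+n 2) (solid-two good x₀ x₁ x₂ x₃ notM₁)
  ... | inj₁ (x₂≡0 , _ , ¬exc) with x₀ ≟ 0#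
  ...   | yes x₀≡0 = covered ℕP.≤-refl (combination-resp (coordinatewise x₀≡0 x₁≡0 x₂≡0 refl refl refl) (axis₃ good x₃))
    where x₁≡0 = ≢-stable (λ x₁≢0 → ¬exc (x₀≡0 , x₁≢0))
  -- x₃ e₃ = x₃ C 1 − x₃ D, and the rest lies on the line ⟨e₀, e₁⟩
  ...   | no x₀≢0 = covered ℕP.≤-refl (combine (one-c x₃ (SG-c 1≢0))
          (combine (one-d (- x₃) SG-d) (line-one {x₀} {x₁ − x₃} (inj₁ x₀≢0)) refl refl refl refl refl refl)
          (l₀ x₀) (l₁ x₁ x₃) (trans x₂≡0 (l₂ x₃)) (l₃ x₃) 0≡0+0+0 0≡0+0+0)
    where
    l₀ : ∀ x₀ → x₀ ≡ 0# + (0# + x₀)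
    l₀ = solve 1 (λ x → x := c0 :+ (c0 :+ x)) refl
    l₁ : ∀ x₁ x₃ → x₁ ≡ x₃ + (0# + (x₁ − x₃))
    l₁ = solve 2 (λ x₁ x₃ → x₁ := x₃ :+ (c0 :+ (x₁ :- x₃))) refl
    l₂ : ∀ x₃ → 0# ≡ x₃ * 1# + (- x₃ + 0#)
    l₂ = solve 1 (λ x₃ → c0 := x₃ :* c1 :+ (:- x₃ :+ c0)) refl
    l₃ : ∀ x₃ → x₃ ≡ x₃ * (1# * 1#) + (0# + 0#)
    l₃ = solve 1 (λ x₃ → x₃ := x₃ :* (c1 :* c1) :+ (c0 :+ c0)) refl

  case-e₄ : GoodOrder → ∀ x₀ x₁ x₂ x₃ {x₄} → x₄ ≢ 0# → Covered 2 SG (vec x₀ x₁ x₂ x₃ x₄ 0#)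
  case-e₄ good x₀ x₁ x₂ x₃ {x₄} x₄≢0 with M₁? x₀ x₁ x₂ x₃
  ... | inj₂ notM₁ = covered ℕP.≤-refl (combine (solid-two good x₀ x₁ x₂ x₃ notM₁) (one-f x₄ SG-f)
          (x≡x+0 x₀) (x≡x+0 x₁) (x≡x+0 x₂) (x≡x+0 x₃) (x≡0+x x₄) 0≡0+0)
  ... | inj₁ (x₂≡0 , x₃≢0 , ¬exc) = with-line x₂≡0 (¬exception⇒line-covered ¬exc)
          (conic₂-secant (secant-t≡0 (3<q good) x₃≢0 x₄≢0))

  case-e₅ : GoodOrder → ∀ x₀ x₁ x₂ x₃ {x₅} → x₅ ≢ 0# → M₁ x₀ x₁ x₂ x₃ → Covered 2 SG (vec x₀ x₁ x₂ x₃ 0# x₅)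
  case-e₅ good x₀ x₁ x₂ x₃ x₅≢0 (x₂≡0 , x₃≢0 , ¬exc) = with-line x₂≡0 (¬exception⇒line-covered ¬exc)
    (conic₂-secant (secant-z≡0 (3<q good) x₃≢0 x₅≢0))

  -- for x₄, x₅ ≠ 0 one point c E a takes care of (x₄, x₅)
  case-conic₂ : GoodOrder → ∀ x₀ x₁ x₂ x₃ {x₄ x₅} → x₄ ≢ 0# → x₅ ≢ 0# → Covered 2 SG (vec x₀ x₁ x₂ x₃ x₄ x₅)
  case-conic₂ good x₀ x₁ x₂ x₃ {x₄} {x₅} x₄≢0 x₅≢0 = through (conic-multiple x₄≢0 x₅≢0)
    where
    through : ConicMultiple x₄ x₅ → Covered 2 SG (vec x₀ x₁ x₂ x₃ x₄ x₅)
    through (a , c , a≢0 , ca≡x₄ , ca²≡x₅) with M₁? x₀ x₁ x₂ (x₃ − c)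
    ... | inj₂ notM₁ = covered ℕP.≤-refl (combine (solid-two good x₀ x₁ x₂ (x₃ − c) notM₁) (one-e c (SG-e a≢0))
          (x≡x+0 x₀) (x≡x+0 x₁) (x≡x+0 x₂) (l x₃ c) (trans (sym ca≡x₄) (x≡0+x _)) (trans (sym ca²≡x₅) (x≡0+x _)))
      where l : ∀ x₃ c → x₃ ≡ (x₃ − c) + c
            l = solve 2 (λ x₃ c → x₃ := (x₃ :- c) :+ c) refl
    ... | inj₁ (x₂≡0 , _ , ¬exc) with x₃ ≟ 0#
    ...   | yes x₃≡0 = with-line x₂≡0 (¬exception⇒line-covered ¬exc)
            (combination-resp (coordinatewise refl refl refl x₃≡0 refl refl) (conic₂-secant (secant-y≡0 (3<q good) x₄≢0 x₅≢0)))
    ...   | no x₃≢0 = with-line x₂≡0 (¬exception⇒line-covered ¬exc) (conic₂-all-nonzero good x₃≢0 x₄≢0 x₅≢0)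

  covered-or-M₂ : GoodOrder → ∀ x → Covered 2 SG x ⊎ M₂ x
  covered-or-M₂ good x with x ℓ₄ ≟ 0# | x ℓ₅ ≟ 0#
  ... | yes x₄≡0 | yes x₅≡0 = inj₁ (covered-resp {X = SG} (coordinatewise refl refl refl refl x₄≡0 x₅≡0)
                                 (case-solid good (x ℓ₀) (x ℓ₁) (x ℓ₂) (x ℓ₃)))
  ... | no x₄≢0 | yes x₅≡0 = inj₁ (covered-resp {X = SG} (coordinatewise refl refl refl refl refl x₅≡0)
                                 (case-e₄ good (x ℓ₀) (x ℓ₁) (x ℓ₂) (x ℓ₃) x₄≢0))
  ... | no x₄≢0 | no x₅≢0 = inj₁ (covered-resp {X = SG} (vec-η x)
                                 (case-conic₂ good (x ℓ₀) (x ℓ₁) (x ℓ₂) (x ℓ₃) x₄≢0 x₅≢0))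
  ... | yes x₄≡0 | no x₅≢0 with M₁? (x ℓ₀) (x ℓ₁) (x ℓ₂) (x ℓ₃)
  ...   | inj₁ m = inj₁ (covered-resp {X = SG} (coordinatewise refl refl refl refl x₄≡0 refl)
                       (case-e₅ good (x ℓ₀) (x ℓ₁) (x ℓ₂) (x ℓ₃) x₅≢0 m))
  ...   | inj₂ notM₁ = inj₂ (x₄≡0 , x₅≢0 , NotM₁⇒¬M₁ notM₁)

module Uncoverable {q : ℕ} (𝔽 : FiniteField q) where

  open FiniteField 𝔽
  open FiniteFieldFacts 𝔽
  open Combinations 𝔽

  Low High : V → Set
  Low p = p ℓ₄ ≡ 0# × p ℓ₅ ≡ 0#
  High p = p ℓ₀ ≡ 0# × p ℓ₁ ≡ 0# × p ℓ₂ ≡ 0#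

  low-or-high : ∀ {p} → S₂ p → Low p ⊎ High p
  low-or-high (inj₁ p≗) = inj₁ (p≗ ℓ₄ , p≗ ℓ₅)
  low-or-high (inj₂ (inj₁ (a , _ , p≗))) = inj₁ (trans (p≗ ℓ₄) (Pb-vec a ℓ₄) , trans (p≗ ℓ₅) (Pb-vec a ℓ₅))
  low-or-high (inj₂ (inj₂ (inj₁ (a , _ , p≗)))) = inj₁ (trans (p≗ ℓ₄) (Pc-vec a ℓ₄) , trans (p≗ ℓ₅) (Pc-vec a ℓ₅))
  low-or-high (inj₂ (inj₂ (inj₂ (inj₁ p≗)))) = inj₁ (p≗ ℓ₄ , p≗ ℓ₅)
  low-or-high (inj₂ (inj₂ (inj₂ (inj₂ (inj₁ (a , _ , p≗)))))) =
    inj₂ (trans (p≗ ℓ₀) (Pe-vec a ℓ₀) , trans (p≗ ℓ₁) (Pe-vec a ℓ₁) , trans (p≗ ℓ₂) (Pe-vec a ℓ₂))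
  low-or-high (inj₂ (inj₂ (inj₂ (inj₂ (inj₂ (inj₁ p≗)))))) = inj₂ (p≗ ℓ₀ , p≗ ℓ₁ , p≗ ℓ₂)
  low-or-high (inj₂ (inj₂ (inj₂ (inj₂ (inj₂ (inj₂ p≗)))))) = inj₂ (p≗ ℓ₀ , p≗ ℓ₁ , p≗ ℓ₂)

  _∩_ : PointSet → (V → Set) → PointSet
  (X ∩ P) p = X p × P p

  vanishing : ∀ {k X w} i → (∀ p → X p → p i ≡ 0#) → Combination k X w → w i ≡ 0#
  vanishing {zero} i _ (combination _ _ _ w≗) = w≗ i
  vanishing {suc k} {X} {w} i zero-at (combination p p∈X c w≗) = begin
    w i                                 ≡⟨ w≗ i ⟩
    c zero * p zero i + lincomb k _ _ i ≡⟨ cong₂ _+_ (trans (cong (c zero *_) (zero-at _ (p∈X zero))) (zeroʳ _))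
                                                     (vanishing {X = X} i zero-at (drop-first p p∈X c)) ⟩
    0# + 0#                             ≡⟨ +-identityʳ 0# ⟩
    0#                                  ∎
    where open ≡-Reasoning

  record Split (k : ℕ) (X : PointSet) (x : V) : Set where
    constructor split-into
    field
      l h : ℕ
      l+h≡k : l ℕ.+ h ≡ k
      L H : V
      low : Combination l (X ∩ Low) L
      high : Combination h (X ∩ High) H
      sum : x ≗ L +V H

  split : ∀ {k X x} → (∀ w → X w → S₂ w) → Combination k X x → Split k X x
  split {zero} _ (combination _ _ _ x≗) =
    split-into 0 0 refl zeroV zeroV combination-zero combination-zero (λ i → trans (x≗ i) (sym (+-identityʳ 0#)))
  split {suc k} {X} {x} X⊆S₂ (combination p p∈X c x≗)
    with split X⊆S₂ (drop-first p p∈X c)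
       | low-or-high (X⊆S₂ _ (p∈X zero))
  ... | split-into l h l+h≡k L H low high rest≗ | inj₁ p-low =
    split-into (suc l) h (cong suc l+h≡k) _ H (combination-cons (c zero) (p∈X zero , p-low) low) high
      (λ i → trans (x≗ i) (trans (cong (c zero * p zero i +_) (rest≗ i)) (sym (+-assoc _ _ _))))
  ... | split-into l h l+h≡k L H low high rest≗ | inj₂ p-high =
    split-into l (suc h) (trans (ℕP.+-suc l h) (cong suc l+h≡k)) L _ low (combination-cons (c zero) (p∈X zero , p-high) high)
      (λ i → trans (x≗ i) (trans (cong (c zero * p zero i +_) (rest≗ i)) (swap _ _ _)))
    where swap : ∀ a b d → a + (b + d) ≡ b + (a + d)
          swap = solve 3 (λ a b d → a :+ (b :+ d) := b :+ (a :+ d)) refl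

  low-coordinate : ∀ {k X x} (s : Split k X x) i → (∀ p → High p → p i ≡ 0#) → x i ≡ Split.L s i
  low-coordinate (split-into _ _ _ L H _ high x≗) i zero-at =
    trans (x≗ i) (trans (cong (L i +_) (vanishing i (λ p (_ , p-high) → zero-at p p-high) high)) (+-identityʳ _))

  high-coordinate : ∀ {k X x} (s : Split k X x) i → (∀ p → Low p → p i ≡ 0#) → x i ≡ Split.H s i
  high-coordinate (split-into _ _ _ L H low _ x≗) i zero-at =
    trans (x≗ i) (trans (cong (_+ H i) (vanishing i (λ p (_ , p-low) → zero-at p p-low) low)) (+-identityˡ _))

  one-point : ∀ {Y L} → Combination 1 Y L → Σ Carrier λ c → Σ V λ p → Y p × (∀ i → L i ≡ c * p i)
  one-point (combination p p∈Y c L≗) = c zero , p zero , p∈Y zero , λ i → trans (L≗ i) (+-identityʳ _)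

  two-points : ∀ {Y L} → Combination 2 Y L →
               Σ Carrier λ c → Σ Carrier λ c′ → Σ V λ p → Σ V λ p′ → Y p × Y p′ × (∀ i → L i ≡ c * p i + c′ * p′ i)
  two-points (combination p p∈Y c L≗) = c zero , c (suc zero) , p zero , p (suc zero) , p∈Y zero , p∈Y (suc zero) ,
    λ i → trans (L≗ i) (cong (c zero * p zero i +_) (+-identityʳ _))

  NeedsLow NeedsHigh : V → Set
  NeedsLow x = ¬ (x ℓ₀ ≡ 0# × x ℓ₁ ≡ 0# × x ℓ₂ ≡ 0#)
  NeedsHigh x = ¬ (x ℓ₄ ≡ 0# × x ℓ₅ ≡ 0#)

  NotOneLow : PointSet → V → Set
  NotOneLow X x = ∀ c p → X p → Low p → ¬ (x ℓ₀ ≡ c * p ℓ₀ × x ℓ₁ ≡ c * p ℓ₁ × x ℓ₂ ≡ c * p ℓ₂)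

  NotTwoLowOneHigh : PointSet → V → Set
  NotTwoLowOneHigh X x = ∀ c c′ c″ p p′ p″ → X p → X p′ → X p″ → Low p → Low p′ → High p″ →
    x ℓ₀ ≡ c * p ℓ₀ + c′ * p′ ℓ₀ → x ℓ₁ ≡ c * p ℓ₁ + c′ * p′ ℓ₁ → x ℓ₂ ≡ c * p ℓ₂ + c′ * p′ ℓ₂ →
    x ℓ₃ ≡ (c * p ℓ₃ + c′ * p′ ℓ₃) + c″ * p″ ℓ₃ → x ℓ₄ ≡ c″ * p″ ℓ₄ → x ℓ₅ ≡ c″ * p″ ℓ₅ → ⊥

  private
    at₀ : ∀ p → High p → p ℓ₀ ≡ 0#
    at₀ _ = proj₁
    at₁ : ∀ p → High p → p ℓ₁ ≡ 0#
    at₁ _ h = proj₁ (proj₂ h)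
    at₂ : ∀ p → High p → p ℓ₂ ≡ 0#
    at₂ _ h = proj₂ (proj₂ h)
    at₄ : ∀ p → Low p → p ℓ₄ ≡ 0#
    at₄ _ = proj₁
    at₅ : ∀ p → Low p → p ℓ₅ ≡ 0#
    at₅ _ = proj₂

  no-low-part : ∀ {k X x} → NeedsLow x → (s : Split k X x) → Split.l s ≢ 0
  no-low-part needs s@(split-into zero _ _ _ _ (combination _ _ _ L≗) _ _) refl =
    needs (vanish ℓ₀ at₀ , vanish ℓ₁ at₁ , vanish ℓ₂ at₂)
    where vanish = λ i zero-at → trans (low-coordinate s i zero-at) (L≗ i)

  no-high-part : ∀ {k X x} → NeedsHigh x → (s : Split k X x) → Split.h s ≢ 0
  no-high-part needs s@(split-into _ zero _ _ _ _ (combination _ _ _ H≗) _) refl =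
    needs (trans (high-coordinate s ℓ₄ at₄) (H≗ ℓ₄) , trans (high-coordinate s ℓ₅ at₅) (H≗ ℓ₅))

  no-single-low : ∀ {k X x} → NotOneLow X x → (s : Split k X x) → Split.l s ≢ 1
  no-single-low notOne s@(split-into (suc zero) _ _ _ _ low _ _) refl with one-point low
  ... | c , p , (p∈X , p-low) , L≡ = notOne c p p∈X p-low
          (coordinate ℓ₀ at₀ , coordinate ℓ₁ at₁ , coordinate ℓ₂ at₂)
    where coordinate = λ i zero-at → trans (low-coordinate s i zero-at) (L≡ i)

  private
    too-many : ∀ a b → ¬ (a ℕ.+ suc b ≤ 0)
    too-many a b le with ℕP.≤-trans (ℕP.m≤n+m (suc b) a) le
    ... | ()

    over-two : ∀ a b → ¬ (suc (suc a) ℕ.+ suc b ≤ 2)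
    over-two a b (s≤s (s≤s le)) = too-many a b le

    over-three : ∀ a b → ¬ (suc (suc (suc a)) ℕ.+ suc b ≤ 3)
    over-three a b (s≤s (s≤s (s≤s le))) = too-many a b le

  uncoverable-by-two : ∀ {X x} → (∀ w → X w → S₂ w) → NeedsLow x → NeedsHigh x → NotOneLow X x →
                       ∀ k → k ≤ 2 → ¬ Combination k X x
  uncoverable-by-two {X} {x} X⊆S₂ needs-low needs-high not-one k k≤2 comb = impossible (split X⊆S₂ comb)
    where
    impossible : Split k X x → ⊥
    impossible s@(split-into zero _ _ _ _ _ _ _) = no-low-part needs-low s refl
    impossible s@(split-into (suc _) zero _ _ _ _ _ _) = no-high-part needs-high s refl
    impossible s@(split-into (suc zero) (suc _) _ _ _ _ _ _) = no-single-low not-one s refl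
    impossible (split-into (suc (suc a)) (suc b) l+h≡k _ _ _ _ _) = over-two a b (subst (_≤ 2) (sym l+h≡k) k≤2)

  uncoverable-by-three : ∀ {X x} → (∀ w → X w → S₂ w) → NeedsLow x → NeedsHigh x → NotOneLow X x →
                         NotTwoLowOneHigh X x → ∀ k → k ≤ 3 → ¬ Combination k X x
  uncoverable-by-three {X} {x} X⊆S₂ needs-low needs-high not-one not-two k k≤3 comb = impossible (split X⊆S₂ comb)
    where
    impossible : Split k X x → ⊥
    impossible s@(split-into zero _ _ _ _ _ _ _) = no-low-part needs-low s refl
    impossible s@(split-into (suc _) zero _ _ _ _ _ _) = no-high-part needs-high s refl
    impossible s@(split-into (suc zero) (suc _) _ _ _ _ _ _) = no-single-low not-one s refl
    impossible (split-into (suc (suc (suc a))) (suc b) l+h≡k _ _ _ _ _) = over-three a b (subst (_≤ 3) (sym l+h≡k) k≤3)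
    impossible (split-into 2 (suc (suc b)) l+h≡k _ _ _ _ _) with subst (_≤ 3) (sym l+h≡k) k≤3
    ... | s≤s (s≤s (s≤s ()))
    impossible s@(split-into 2 1 _ L H low high x≗) with two-points low | one-point high
    ... | c , c′ , p , p′ , (p∈X , p-low) , (p′∈X , p′-low) , L≡ | c″ , p″ , (p″∈X , p″-high) , H≡ =
      not-two c c′ c″ p p′ p″ p∈X p′∈X p″∈X p-low p′-low p″-high
        (low-part ℓ₀ at₀) (low-part ℓ₁ at₁) (low-part ℓ₂ at₂) (trans (x≗ ℓ₃) (cong₂ _+_ (L≡ ℓ₃) (H≡ ℓ₃)))
        (high-part ℓ₄ at₄) (high-part ℓ₅ at₅)
      where
      low-part = λ i zero-at → trans (low-coordinate s i zero-at) (L≡ i)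
      high-part = λ i zero-at → trans (high-coordinate s i zero-at) (H≡ i)

  no-high-match : ∀ {X x} → (∀ c p → X p → High p → ¬ (x ℓ₄ ≡ c * p ℓ₄ × x ℓ₅ ≡ c * p ℓ₅)) → NotTwoLowOneHigh X x
  no-high-match no-match _ _ c″ _ _ p″ _ _ p″∈X _ _ p″-high _ _ _ _ x₄≡ x₅≡ = no-match c″ p″ p″∈X p″-high (x₄≡ , x₅≡)

  PairEq : V → Carrier → Carrier → V → V → Set
  PairEq x c c′ p p′ = x ℓ₀ ≡ c * p ℓ₀ + c′ * p′ ℓ₀ × x ℓ₁ ≡ c * p ℓ₁ + c′ * p′ ℓ₁ ×
                       x ℓ₂ ≡ c * p ℓ₂ + c′ * p′ ℓ₂ × x ℓ₃ ≡ c * p ℓ₃ + c′ * p′ ℓ₃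

  swap-pair : ∀ {x c c′ p p′} → PairEq x c c′ p p′ → PairEq x c′ c p′ p
  swap-pair (e₀ , e₁ , e₂ , e₃) = flip e₀ , flip e₁ , flip e₂ , flip e₃
    where flip = λ {a} {u} {v} (e : a ≡ u + v) → trans e (+-comm u v)

  no-low-pair : ∀ {X x} →
    (∀ c p → X p → High p → x ℓ₄ ≡ c * p ℓ₄ → x ℓ₅ ≡ c * p ℓ₅ → c * p ℓ₃ ≡ 0#) →
    (∀ c c′ p p′ → X p → X p′ → Low p → Low p′ → ¬ PairEq x c c′ p p′) →
    NotTwoLowOneHigh X x
  no-low-pair no-contribution no-pair c c′ c″ p p′ p″ p∈X p′∈X p″∈X p-low p′-low p″-high x₀≡ x₁≡ x₂≡ x₃≡ x₄≡ x₅≡ =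
    no-pair c c′ p p′ p∈X p′∈X p-low p′-low
      (x₀≡ , x₁≡ , x₂≡ , trans x₃≡ (trans (cong (c * p ℓ₃ + c′ * p′ ℓ₃ +_)
        (no-contribution c″ p″ p″∈X p″-high x₄≡ x₅≡)) (+-identityʳ _)))

  data LowForm (p : V) : Set where
    form-a : p ≗ vec 1# 0# 0# 0# 0# 0# → LowForm p
    form-b : ∀ b → b ≢ 0# → p ≗ vec 1# b 0# 0# 0# 0# → LowForm p
    form-c : ∀ b → b ≢ 0# → p ≗ vec 0# 1# b (b * b) 0# 0# → LowForm p
    form-d : p ≗ vec 0# 0# 1# 0# 0# 0# → LowForm p

  data LowKind (p : V) : Set where
    on-line : p ℓ₂ ≡ 0# → p ℓ₃ ≡ 0# → LowKind p
    on-conic : ∀ b → b ≢ 0# → p ≗ vec 0# 1# b (b * b) 0# 0# → LowKind p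
    is-d : p ≗ vec 0# 0# 1# 0# 0# 0# → LowKind p

  kind : ∀ {p} → LowForm p → LowKind p
  kind (form-a p≗) = on-line (p≗ ℓ₂) (p≗ ℓ₃)
  kind (form-b _ _ p≗) = on-line (p≗ ℓ₂) (p≗ ℓ₃)
  kind (form-c b b≢0 p≗) = on-conic b b≢0 p≗
  kind (form-d p≗) = is-d p≗

  data HighForm (p : V) : Set where
    form-e : ∀ b → b ≢ 0# → p ≗ vec 0# 0# 0# 1# b (b * b) → HighForm p
    form-f : p ≗ vec 0# 0# 0# 0# 1# 0# → HighForm p
    form-g : p ≗ vec 0# 0# 0# 0# 0# 1# → HighForm p

  0≢1-at : ∀ {p : V} {m : V} i → p ≗ m → m i ≡ 1# → p i ≡ 0# → ⊥
  0≢1-at i p≗m mᵢ≡1 pᵢ≡0 = 1≢0 (trans (sym mᵢ≡1) (trans (sym (p≗m i)) pᵢ≡0))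

  low-form : ∀ {p} → S₂ p → Low p → LowForm p
  low-form (inj₁ p≗) _ = form-a (≗-trans p≗ Pa-vec)
  low-form (inj₂ (inj₁ (a , a≢0 , p≗))) _ = form-b a a≢0 (≗-trans p≗ (Pb-vec a))
  low-form (inj₂ (inj₂ (inj₁ (a , a≢0 , p≗)))) _ = form-c a a≢0 (≗-trans p≗ (Pc-vec a))
  low-form (inj₂ (inj₂ (inj₂ (inj₁ p≗)))) _ = form-d (≗-trans p≗ Pd-vec)
  low-form (inj₂ (inj₂ (inj₂ (inj₂ (inj₁ (a , a≢0 , p≗)))))) (p₄≡0 , _) = ⊥-elim (a≢0 (trans (sym (≗-trans p≗ (Pe-vec a) ℓ₄)) p₄≡0))
  low-form (inj₂ (inj₂ (inj₂ (inj₂ (inj₂ (inj₁ p≗)))))) (p₄≡0 , _) = ⊥-elim (0≢1-at ℓ₄ (≗-trans p≗ Pf-vec) refl p₄≡0)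
  low-form (inj₂ (inj₂ (inj₂ (inj₂ (inj₂ (inj₂ p≗)))))) (_ , p₅≡0) = ⊥-elim (0≢1-at ℓ₅ (≗-trans p≗ Pg-vec) refl p₅≡0)

  high-form : ∀ {p} → S₂ p → High p → HighForm p
  high-form (inj₁ p≗) (p₀≡0 , _) = ⊥-elim (0≢1-at ℓ₀ (≗-trans p≗ Pa-vec) refl p₀≡0)
  high-form (inj₂ (inj₁ (a , _ , p≗))) (p₀≡0 , _) = ⊥-elim (0≢1-at ℓ₀ (≗-trans p≗ (Pb-vec a)) refl p₀≡0)
  high-form (inj₂ (inj₂ (inj₁ (a , _ , p≗)))) (_ , p₁≡0 , _) = ⊥-elim (0≢1-at ℓ₁ (≗-trans p≗ (Pc-vec a)) refl p₁≡0)
  high-form (inj₂ (inj₂ (inj₂ (inj₁ p≗)))) (_ , _ , p₂≡0) = ⊥-elim (0≢1-at ℓ₂ (≗-trans p≗ Pd-vec) refl p₂≡0)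
  high-form (inj₂ (inj₂ (inj₂ (inj₂ (inj₁ (a , a≢0 , p≗)))))) _ = form-e a a≢0 (≗-trans p≗ (Pe-vec a))
  high-form (inj₂ (inj₂ (inj₂ (inj₂ (inj₂ (inj₁ p≗)))))) _ = form-f (≗-trans p≗ Pf-vec)
  high-form (inj₂ (inj₂ (inj₂ (inj₂ (inj₂ (inj₂ p≗)))))) _ = form-g (≗-trans p≗ Pg-vec)

-- For each point w₀ of S₂ a vector with x₀ = 1 that is not a combination of
-- at most three points of S₂ ∖ {w₀}; this gives the minimality of S₂.
module Witnesses {q : ℕ} (𝔽 : FiniteField q) where

  open FiniteField 𝔽
  open FiniteFieldFacts 𝔽
  open Combinations 𝔽
  open Uncoverable 𝔽

  private
    c·0≡0 : ∀ {a} c → a ≡ 0# → c * a ≡ 0#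
    c·0≡0 c a≡0 = trans (cong (c *_) a≡0) (zeroʳ c)

    1≢c·0 : ∀ {c a} → a ≡ 0# → 1# ≡ c * a → ⊥
    1≢c·0 {c} a≡0 e = 1≢0 (trans e (c·0≡0 c a≡0))

    c·b² : ∀ c b → c * (b * b) ≡ (c * b) * b
    c·b² = solve 2 (λ c b → c :* (b :* b) := (c :* b) :* b) refl

    c·b²≡0 : ∀ {c b} → c * b ≡ 0# → c * (b * b) ≡ 0#
    c·b²≡0 {c} {b} cb≡0 = trans (c·b² c b) (trans (cong (_* b) cb≡0) (zeroˡ b))

    c·b²≡ : ∀ {c b a} → c * b ≡ a → c * (b * b) ≡ a * b
    c·b²≡ {c} {b} cb≡a = trans (c·b² c b) (cong (_* b) cb≡a)

    c·b≡1⇒c·b²≢0 : ∀ {c b} → b ≢ 0# → c * b ≡ 1# → c * (b * b) ≢ 0#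
    c·b≡1⇒c·b²≢0 {c} {b} b≢0 cb≡1 cb²≡0 = b≢0 (trans (sym (trans (c·b²≡ cb≡1) (*-identityˡ b))) cb²≡0)

    sum-zero : ∀ {c c′ a a′} → a ≡ 0# → a′ ≡ 0# → c * a + c′ * a′ ≡ 0#
    sum-zero {c} {c′} a≡0 a′≡0 = trans (cong₂ _+_ (c·0≡0 c a≡0) (c·0≡0 c′ a′≡0)) (+-identityʳ 0#)

    sum-left : ∀ {c c′ a a′} → a′ ≡ 0# → c * a + c′ * a′ ≡ c * a
    sum-left {c} {c′} a′≡0 = trans (cong (c * _ +_) (c·0≡0 c′ a′≡0)) (+-identityʳ _)

    1≢sum-zero : ∀ {c c′ a a′} → a ≡ 0# → a′ ≡ 0# → 1# ≡ c * a + c′ * a′ → ⊥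
    1≢sum-zero a≡0 a′≡0 e = 1≢0 (trans e (sum-zero a≡0 a′≡0))

    same-point : ∀ {p w₀ m} → p ≗ m → w₀ ≗ m → Proportional p w₀
    same-point {p} {w₀} p≗m w₀≗m = 1# , 1≢0 , λ i → trans (p≗m i) (trans (sym (w₀≗m i)) (sym (*-identityˡ (w₀ i))))

  Without : V → PointSet
  Without w₀ = S₂ ∖ₚ w₀

  without⊆S₂ : ∀ {w₀} w → Without w₀ w → S₂ w
  without⊆S₂ _ = proj₁

  not-one-low-101 : ∀ {X x} → (∀ w → X w → S₂ w) → x ℓ₀ ≡ 1# → x ℓ₂ ≡ 1# → NotOneLow X x
  not-one-low-101 X⊆S₂ x₀≡1 x₂≡1 c p p∈X p-low (x₀≡ , _ , x₂≡) with low-form (X⊆S₂ p p∈X) p-low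
  ... | form-a p≗ = 1≢c·0 (p≗ ℓ₂) (trans (sym x₂≡1) x₂≡)
  ... | form-b _ _ p≗ = 1≢c·0 (p≗ ℓ₂) (trans (sym x₂≡1) x₂≡)
  ... | form-c _ _ p≗ = 1≢c·0 (p≗ ℓ₀) (trans (sym x₀≡1) x₀≡)
  ... | form-d p≗ = 1≢c·0 (p≗ ℓ₀) (trans (sym x₀≡1) x₀≡)

  -- high points matching (x₄, x₅) = (1, 0) can only be multiples of F
  no-contribution-10 : ∀ {X : PointSet} {x : V} → (∀ w → X w → S₂ w) → x ℓ₄ ≡ 1# → x ℓ₅ ≡ 0# →
                       ∀ c p → X p → High p → x ℓ₄ ≡ c * p ℓ₄ → x ℓ₅ ≡ c * p ℓ₅ → c * p ℓ₃ ≡ 0#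
  no-contribution-10 X⊆S₂ x₄≡1 x₅≡0 c p p∈X p-high x₄≡ x₅≡ with high-form (X⊆S₂ p p∈X) p-high
  ... | form-e b b≢0 p≗ = ⊥-elim (c·b≡1⇒c·b²≢0 b≢0 (sym (trans (sym x₄≡1) (trans x₄≡ (cong (c *_) (p≗ ℓ₄)))))
                                                   (sym (trans (sym x₅≡0) (trans x₅≡ (cong (c *_) (p≗ ℓ₅))))))
  ... | form-f p≗ = c·0≡0 c (p≗ ℓ₃)
  ... | form-g p≗ = ⊥-elim (1≢c·0 (p≗ ℓ₄) (trans (sym x₄≡1) x₄≡))

  not-1-covered : ∀ k → k ≤ 2 → ¬ Combination k S₂ (vec 1# 0# 1# 0# 1# 0#)
  not-1-covered = uncoverable-by-two (λ _ p → p) (λ x₀≡0 → 1≢0 (proj₁ x₀≡0)) (λ x₄≡0 → 1≢0 (proj₁ x₄≡0))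
    (not-one-low-101 {x = vec 1# 0# 1# 0# 1# 0#} (λ _ p → p) refl refl)

  without-g : ∀ {w₀} → w₀ ≗ vec 0# 0# 0# 0# 0# 1# → ∀ k → k ≤ 3 → ¬ Combination k (Without w₀) (vec 1# 0# 1# 0# 0# 1#)
  without-g {w₀} w₀≗ = uncoverable-by-three without⊆S₂ (λ x₀≡0 → 1≢0 (proj₁ x₀≡0)) (λ x₅≡0 → 1≢0 (proj₂ x₅≡0))
    (not-one-low-101 {x = vec 1# 0# 1# 0# 0# 1#} without⊆S₂ refl refl) (no-high-match {x = vec 1# 0# 1# 0# 0# 1#} no-match)
    where
    no-match : ∀ c p → Without w₀ p → High p → ¬ (0# ≡ c * p ℓ₄ × 1# ≡ c * p ℓ₅)
    no-match c p (p∈S₂ , p≁w₀) p-high (x₄≡ , x₅≡) with high-form p∈S₂ p-high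
    ... | form-e b _ p≗ = 1≢0 (trans x₅≡ (trans (cong (c *_) (p≗ ℓ₅)) (c·b²≡0 (sym (trans x₄≡ (cong (c *_) (p≗ ℓ₄)))))))
    ... | form-f p≗ = 1≢c·0 (p≗ ℓ₅) x₅≡
    ... | form-g p≗ = p≁w₀ (same-point p≗ w₀≗)

  without-f : ∀ {w₀} → w₀ ≗ vec 0# 0# 0# 0# 1# 0# → ∀ k → k ≤ 3 → ¬ Combination k (Without w₀) (vec 1# 0# 1# 0# 1# 0#)
  without-f {w₀} w₀≗ = uncoverable-by-three without⊆S₂ (λ x₀≡0 → 1≢0 (proj₁ x₀≡0)) (λ x₄≡0 → 1≢0 (proj₁ x₄≡0))
    (not-one-low-101 {x = vec 1# 0# 1# 0# 1# 0#} without⊆S₂ refl refl) (no-high-match {x = vec 1# 0# 1# 0# 1# 0#} no-match)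
    where
    no-match : ∀ c p → Without w₀ p → High p → ¬ (1# ≡ c * p ℓ₄ × 0# ≡ c * p ℓ₅)
    no-match c p (p∈S₂ , p≁w₀) p-high (x₄≡ , x₅≡) with high-form p∈S₂ p-high
    ... | form-e b b≢0 p≗ = c·b≡1⇒c·b²≢0 b≢0 (sym (trans x₄≡ (cong (c *_) (p≗ ℓ₄)))) (sym (trans x₅≡ (cong (c *_) (p≗ ℓ₅))))
    ... | form-f p≗ = p≁w₀ (same-point p≗ w₀≗)
    ... | form-g p≗ = 1≢c·0 (p≗ ℓ₄) x₄≡

  without-e : ∀ {w₀ a} → a ≢ 0# → w₀ ≗ vec 0# 0# 0# 1# a (a * a) →
              ∀ k → k ≤ 3 → ¬ Combination k (Without w₀) (vec 1# 0# 1# 0# a (a * a))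
  without-e {w₀} {a} a≢0 w₀≗ = uncoverable-by-three without⊆S₂ (λ x₀≡0 → 1≢0 (proj₁ x₀≡0)) (λ x₄≡0 → a≢0 (proj₁ x₄≡0))
    (not-one-low-101 {x = vec 1# 0# 1# 0# a (a * a)} without⊆S₂ refl refl) (no-high-match {x = vec 1# 0# 1# 0# a (a * a)} no-match)
    where
    no-match : ∀ c p → Without w₀ p → High p → ¬ (a ≡ c * p ℓ₄ × a * a ≡ c * p ℓ₅)
    no-match c p (p∈S₂ , p≁w₀) p-high (x₄≡ , x₅≡) with high-form p∈S₂ p-high
    ... | form-e b _ p≗ = p≁w₀ (same-point (≗-trans p≗ (coordinatewise refl refl refl refl (sym a≡b) (cong (λ u → u * u) (sym a≡b)))) w₀≗)
      where
      cb≡a : c * b ≡ a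
      cb≡a = sym (trans x₄≡ (cong (c *_) (p≗ ℓ₄)))
      a≡b : a ≡ b
      a≡b = *-cancelˡ a≢0 (trans x₅≡ (trans (cong (c *_) (p≗ ℓ₅)) (c·b²≡ cb≡a)))
    ... | form-f p≗ = *-nonzero a≢0 a≢0 (trans x₅≡ (c·0≡0 c (p≗ ℓ₅)))
    ... | form-g p≗ = a≢0 (trans x₄≡ (c·0≡0 c (p≗ ℓ₄)))

  without-d : ∀ {w₀} → w₀ ≗ vec 0# 0# 1# 0# 0# 0# → ∀ k → k ≤ 3 → ¬ Combination k (Without w₀) (vec 1# 0# 1# 0# 0# 1#)
  without-d {w₀} w₀≗ = uncoverable-by-three without⊆S₂ (λ x₀≡0 → 1≢0 (proj₁ x₀≡0)) (λ x₅≡0 → 1≢0 (proj₂ x₅≡0))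
    (not-one-low-101 {x = x} without⊆S₂ refl refl) (no-low-pair {x = x} no-contribution no-pair)
    where
    x = vec 1# 0# 1# 0# 0# 1#
    no-contribution : ∀ c p → Without w₀ p → High p → 0# ≡ c * p ℓ₄ → 1# ≡ c * p ℓ₅ → c * p ℓ₃ ≡ 0#
    no-contribution c p (p∈S₂ , _) p-high x₄≡ x₅≡ with high-form p∈S₂ p-high
    ... | form-e b _ p≗ = ⊥-elim (1≢0 (trans x₅≡ (trans (cong (c *_) (p≗ ℓ₅)) (c·b²≡0 (sym (trans x₄≡ (cong (c *_) (p≗ ℓ₄))))))))
    ... | form-f p≗ = ⊥-elim (1≢c·0 (p≗ ℓ₅) x₅≡)
    ... | form-g p≗ = c·0≡0 c (p≗ ℓ₃)
    conic-line : ∀ c c′ p p′ {b} → b ≢ 0# → p ≗ vec 0# 1# b (b * b) 0# 0# → p′ ℓ₂ ≡ 0# → p′ ℓ₃ ≡ 0# → ¬ PairEq x c c′ p p′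
    conic-line c _ _ _ b≢0 p≗ p′₂≡0 p′₃≡0 (_ , _ , x₂≡ , x₃≡) = c·b≡1⇒c·b²≢0 b≢0
      (sym (trans x₂≡ (trans (sum-left p′₂≡0) (cong (c *_) (p≗ ℓ₂)))))
      (sym (trans x₃≡ (trans (sum-left p′₃≡0) (cong (c *_) (p≗ ℓ₃)))))
    no-pair : ∀ c c′ p p′ → Without w₀ p → Without w₀ p′ → Low p → Low p′ → ¬ PairEq x c c′ p p′
    no-pair c c′ p p′ (p∈S₂ , p≁w₀) (p′∈S₂ , p′≁w₀) p-low p′-low eq
      with kind (low-form p∈S₂ p-low) | kind (low-form p′∈S₂ p′-low)
    ... | is-d p≗ | _ = p≁w₀ (same-point p≗ w₀≗)
    ... | _ | is-d p′≗ = p′≁w₀ (same-point p′≗ w₀≗)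
    ... | on-conic _ _ p≗ | on-conic _ _ p′≗ = 1≢sum-zero (p≗ ℓ₀) (p′≗ ℓ₀) (proj₁ eq)
    ... | on-conic _ b≢0 p≗ | on-line p′₂≡0 p′₃≡0 = conic-line c c′ p p′ b≢0 p≗ p′₂≡0 p′₃≡0 eq
    ... | on-line p₂≡0 p₃≡0 | on-conic _ b≢0 p′≗ = conic-line c′ c p′ p b≢0 p′≗ p₂≡0 p₃≡0 (swap-pair {x} {c} {c′} {p} {p′} eq)
    ... | on-line p₂≡0 _ | on-line p′₂≡0 _ = 1≢sum-zero p₂≡0 p′₂≡0 (proj₁ (proj₂ (proj₂ eq)))

  without-ab : ∀ {w₀ a} → w₀ ≗ vec 1# a 0# 0# 0# 0# → ∀ k → k ≤ 3 → ¬ Combination k (Without w₀) (vec 1# a 0# 1# 1# 0#)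
  without-ab {w₀} {a} w₀≗ = uncoverable-by-three without⊆S₂ (λ x₀≡0 → 1≢0 (proj₁ x₀≡0)) (λ x₄≡0 → 1≢0 (proj₁ x₄≡0))
    not-one (no-low-pair {x = x} (no-contribution-10 {x = x} without⊆S₂ refl refl) no-pair)
    where
    x = vec 1# a 0# 1# 1# 0#
    -- a single point c A or c B b matching (1, a, 0) has c = 1 and is the removed point
    not-one : NotOneLow (Without w₀) x
    not-one c p (p∈S₂ , p≁w₀) p-low (x₀≡ , x₁≡ , _) with low-form p∈S₂ p-low
    ... | form-a p≗ = p≁w₀ (same-point (≗-trans p≗ (coordinatewise refl (sym (trans x₁≡ (c·0≡0 c (p≗ ℓ₁)))) refl refl refl refl)) w₀≗)
    ... | form-b b _ p≗ = p≁w₀ (same-point (≗-trans p≗ (coordinatewise refl (sym a≡b) refl refl refl refl)) w₀≗)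
      where
      c≡1 : c ≡ 1#
      c≡1 = sym (trans x₀≡ (trans (cong (c *_) (p≗ ℓ₀)) (*-identityʳ c)))
      a≡b : a ≡ b
      a≡b = trans x₁≡ (trans (cong (c *_) (p≗ ℓ₁)) (trans (cong (_* b) c≡1) (*-identityˡ b)))
    ... | form-c _ _ p≗ = 1≢c·0 (p≗ ℓ₀) x₀≡
    ... | form-d p≗ = 1≢c·0 (p≗ ℓ₀) x₀≡
    conic-line : ∀ c c′ p p′ {b} → p ≗ vec 0# 1# b (b * b) 0# 0# → p′ ℓ₂ ≡ 0# → p′ ℓ₃ ≡ 0# → ¬ PairEq x c c′ p p′
    conic-line c _ _ _ p≗ p′₂≡0 p′₃≡0 (_ , _ , x₂≡ , x₃≡) = 1≢0 (trans x₃≡ (trans (sum-left p′₃≡0) (trans (cong (c *_) (p≗ ℓ₃))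
      (c·b²≡0 (sym (trans x₂≡ (trans (sum-left p′₂≡0) (cong (c *_) (p≗ ℓ₂)))))))))
    no-pair : ∀ c c′ p p′ → Without w₀ p → Without w₀ p′ → Low p → Low p′ → ¬ PairEq x c c′ p p′
    no-pair c c′ p p′ (p∈S₂ , _) (p′∈S₂ , _) p-low p′-low eq
      with kind (low-form p∈S₂ p-low) | kind (low-form p′∈S₂ p′-low)
    ... | on-conic _ _ p≗ | on-conic _ _ p′≗ = 1≢sum-zero (p≗ ℓ₀) (p′≗ ℓ₀) (proj₁ eq)
    ... | on-conic _ _ p≗ | is-d p′≗ = 1≢sum-zero (p≗ ℓ₀) (p′≗ ℓ₀) (proj₁ eq)
    ... | is-d p≗ | on-conic _ _ p′≗ = 1≢sum-zero (p≗ ℓ₀) (p′≗ ℓ₀) (proj₁ eq)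
    ... | on-conic _ _ p≗ | on-line p′₂≡0 p′₃≡0 = conic-line c c′ p p′ p≗ p′₂≡0 p′₃≡0 eq
    ... | on-line p₂≡0 p₃≡0 | on-conic _ _ p′≗ = conic-line c′ c p′ p p′≗ p₂≡0 p₃≡0 (swap-pair {x} {c} {c′} {p} {p′} eq)
    ... | on-line _ p₃≡0 | on-line _ p′₃≡0 = 1≢sum-zero p₃≡0 p′₃≡0 (proj₂ (proj₂ (proj₂ eq)))
    ... | on-line _ p₃≡0 | is-d p′≗ = 1≢sum-zero p₃≡0 (p′≗ ℓ₃) (proj₂ (proj₂ (proj₂ eq)))
    ... | is-d p≗ | on-line _ p′₃≡0 = 1≢sum-zero (p≗ ℓ₃) p′₃≡0 (proj₂ (proj₂ (proj₂ eq)))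
    ... | is-d p≗ | is-d p′≗ = 1≢sum-zero (p≗ ℓ₃) (p′≗ ℓ₃) (proj₂ (proj₂ (proj₂ eq)))

  without-c : ∀ {w₀ a} → a ≢ 0# → w₀ ≗ vec 0# 1# a (a * a) 0# 0# →
              ∀ k → k ≤ 3 → ¬ Combination k (Without w₀) (vec 1# 0# a (a * a) 1# 0#)
  without-c {w₀} {a} a≢0 w₀≗ = uncoverable-by-three without⊆S₂ (λ x₀≡0 → 1≢0 (proj₁ x₀≡0)) (λ x₄≡0 → 1≢0 (proj₁ x₄≡0))
    not-one (no-low-pair {x = x} (no-contribution-10 {x = x} without⊆S₂ refl refl) no-pair)
    where
    x = vec 1# 0# a (a * a) 1# 0#
    not-one : NotOneLow (Without w₀) x
    not-one c p (p∈S₂ , _) p-low (x₀≡ , _ , x₂≡) with low-form p∈S₂ p-low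
    ... | form-a p≗ = a≢0 (trans x₂≡ (c·0≡0 c (p≗ ℓ₂)))
    ... | form-b _ _ p≗ = a≢0 (trans x₂≡ (c·0≡0 c (p≗ ℓ₂)))
    ... | form-c _ _ p≗ = 1≢c·0 (p≗ ℓ₀) x₀≡
    ... | form-d p≗ = 1≢c·0 (p≗ ℓ₀) x₀≡
    -- c C b + c′ p′ with p′ on the line matches (a, a²) only for b = a
    conic-line : ∀ c c′ p p′ {b} → p ≗ vec 0# 1# b (b * b) 0# 0# → ¬ Proportional p w₀ →
                 p′ ℓ₂ ≡ 0# → p′ ℓ₃ ≡ 0# → ¬ PairEq x c c′ p p′
    conic-line c _ _ _ {b} p≗ p≁w₀ p′₂≡0 p′₃≡0 (_ , _ , x₂≡ , x₃≡) =
      p≁w₀ (same-point (≗-trans p≗ (coordinatewise refl refl (sym a≡b) (cong (λ u → u * u) (sym a≡b)) refl refl)) w₀≗)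
      where
      cb≡a : c * b ≡ a
      cb≡a = sym (trans x₂≡ (trans (sum-left p′₂≡0) (cong (c *_) (p≗ ℓ₂))))
      a≡b : a ≡ b
      a≡b = *-cancelˡ a≢0 (trans x₃≡ (trans (sum-left p′₃≡0) (trans (cong (c *_) (p≗ ℓ₃)) (c·b²≡ cb≡a))))
    a²≢sum-zero : ∀ {c c′ u u′} → u ≡ 0# → u′ ≡ 0# → a * a ≢ c * u + c′ * u′
    a²≢sum-zero u≡0 u′≡0 e = *-nonzero a≢0 a≢0 (trans e (sum-zero u≡0 u′≡0))
    no-pair : ∀ c c′ p p′ → Without w₀ p → Without w₀ p′ → Low p → Low p′ → ¬ PairEq x c c′ p p′
    no-pair c c′ p p′ (p∈S₂ , p≁w₀) (p′∈S₂ , p′≁w₀) p-low p′-low eq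
      with kind (low-form p∈S₂ p-low) | kind (low-form p′∈S₂ p′-low)
    ... | on-conic _ _ p≗ | on-conic _ _ p′≗ = 1≢sum-zero (p≗ ℓ₀) (p′≗ ℓ₀) (proj₁ eq)
    ... | on-conic _ _ p≗ | is-d p′≗ = 1≢sum-zero (p≗ ℓ₀) (p′≗ ℓ₀) (proj₁ eq)
    ... | is-d p≗ | on-conic _ _ p′≗ = 1≢sum-zero (p≗ ℓ₀) (p′≗ ℓ₀) (proj₁ eq)
    ... | is-d p≗ | is-d p′≗ = 1≢sum-zero (p≗ ℓ₀) (p′≗ ℓ₀) (proj₁ eq)
    ... | on-conic _ _ p≗ | on-line p′₂≡0 p′₃≡0 = conic-line c c′ p p′ p≗ p≁w₀ p′₂≡0 p′₃≡0 eq
    ... | on-line p₂≡0 p₃≡0 | on-conic _ _ p′≗ = conic-line c′ c p′ p p′≗ p′≁w₀ p₂≡0 p₃≡0 (swap-pair {x} {c} {c′} {p} {p′} eq)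
    ... | on-line _ p₃≡0 | on-line _ p′₃≡0 = a²≢sum-zero p₃≡0 p′₃≡0 (proj₂ (proj₂ (proj₂ eq)))
    ... | on-line _ p₃≡0 | is-d p′≗ = a²≢sum-zero p₃≡0 (p′≗ ℓ₃) (proj₂ (proj₂ (proj₂ eq)))
    ... | is-d p≗ | on-line _ p′₃≡0 = a²≢sum-zero (p≗ ℓ₃) p′₃≡0 (proj₂ (proj₂ (proj₂ eq)))

  Witness : V → Set
  Witness w₀ = Σ V λ x → x ℓ₀ ≡ 1# × (∀ k → k ≤ 3 → ¬ Combination k (Without w₀) x)

  witness : ∀ {w₀} → S₂ w₀ → Witness w₀
  witness (inj₁ w₀≗) = _ , refl , without-ab {a = 0#} (≗-trans w₀≗ Pa-vec)
  witness (inj₂ (inj₁ (a , _ , w₀≗))) = _ , refl , without-ab (≗-trans w₀≗ (Pb-vec a))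
  witness (inj₂ (inj₂ (inj₁ (a , a≢0 , w₀≗)))) = _ , refl , without-c a≢0 (≗-trans w₀≗ (Pc-vec a))
  witness (inj₂ (inj₂ (inj₂ (inj₁ w₀≗)))) = _ , refl , without-d (≗-trans w₀≗ Pd-vec)
  witness (inj₂ (inj₂ (inj₂ (inj₂ (inj₁ (a , a≢0 , w₀≗)))))) = _ , refl , without-e a≢0 (≗-trans w₀≗ (Pe-vec a))
  witness (inj₂ (inj₂ (inj₂ (inj₂ (inj₂ (inj₁ w₀≗)))))) = _ , refl , without-f (≗-trans w₀≗ Pf-vec)
  witness (inj₂ (inj₂ (inj₂ (inj₂ (inj₂ (inj₂ w₀≗)))))) = _ , refl , without-g (≗-trans w₀≗ Pg-vec)

  lincomb-cong : ∀ k {c c′ : Fin k → Carrier} {p p′ : Fin k → V} →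
                 (∀ i j → c i * p i j ≡ c′ i * p′ i j) → lincomb k c p ≗ lincomb k c′ p′
  lincomb-cong zero _ _ = refl
  lincomb-cong (suc k) e j = cong₂ _+_ (e zero j) (lincomb-cong k (λ i → e (suc i)) j)

  -- Replacing each point of a set T of points of S₂ by its representative
  -- in S₂ turns a combination over T into one over S₂ ∖ {w₀}, if w₀ ∉ T.
  transfer : ∀ {T w₀ k x} → T ⊆ₚ S₂ → ¬ (w₀ ∈ₚ T) → Combination k T x → Combination k (Without w₀) x
  transfer {T} {w₀} {k} T⊆S₂ w₀∉T (combination p p∈T c x≗) =
    combination p′ p′∈ c′ (λ j → trans (x≗ j) (lincomb-cong k rescale j))
    where
    rep : ∀ i → p i ∈ₚ S₂
    rep i = T⊆S₂ (p i) (p∈T i)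
    p′ : Fin k → V
    p′ i = proj₁ (rep i)
    d : Fin k → Carrier
    d i = proj₁ (proj₂ (proj₂ (rep i)))
    d≢0 : ∀ i → d i ≢ 0#
    d≢0 i = proj₁ (proj₂ (proj₂ (proj₂ (rep i))))
    p′≗ : ∀ i → p′ i ≗ d i · p i
    p′≗ i = proj₂ (proj₂ (proj₂ (proj₂ (rep i))))
    c′ : Fin k → Carrier
    c′ i = c i * d i ⁻¹
    rescale : ∀ i j → c i * p i j ≡ c′ i * p′ i j
    rescale i j = begin
      c i * p i j                       ≡⟨ cong (c i *_) (sym (⁻¹-cancelˡ (p i j) (d≢0 i))) ⟩
      c i * (d i ⁻¹ * (d i * p i j))    ≡⟨ sym (*-assoc (c i) _ _) ⟩
      c′ i * (d i * p i j)              ≡⟨ cong (c′ i *_) (sym (p′≗ i j)) ⟩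
      c′ i * p′ i j                     ∎
      where open ≡-Reasoning
    p′∈ : ∀ i → Without w₀ (p′ i)
    p′∈ i = proj₁ (proj₂ (rep i)) , p′≁w₀
      where
      p′≁w₀ : ¬ Proportional (p′ i) w₀
      p′≁w₀ (e , e≢0 , p′≗ew₀) = w₀∉T (p i , p∈T i , d i ⁻¹ * e , *-nonzero (⁻¹-nonzero (d≢0 i)) e≢0 , λ j → begin
        p i j                       ≡⟨ sym (⁻¹-cancelˡ (p i j) (d≢0 i)) ⟩
        d i ⁻¹ * (d i * p i j)      ≡⟨ cong (d i ⁻¹ *_) (trans (sym (p′≗ i j)) (p′≗ew₀ j)) ⟩
        d i ⁻¹ * (e * w₀ j)         ≡⟨ sym (*-assoc _ e (w₀ j)) ⟩
        d i ⁻¹ * e * w₀ j           ∎)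
        where open ≡-Reasoning

  nonzero-witness : ∀ {x : V} → x ℓ₀ ≡ 1# → NonZeroV x
  nonzero-witness x₀≡1 x≗0 = 1≢0 (trans (sym x₀≡1) (x≗0 ℓ₀))

  -- S₂ is minimal: no proper subset T of S₂ is 2-saturating, since the witness
  -- of a point of S₂ ∖ T is not 2-covered by T.
  minimal : ∀ T → T ⊂ₚ S₂ → ¬ Saturating 2 T
  minimal T (T⊆S₂ , w₀ , w₀∈S₂ , w₀∉T) (T-covers , _) with witness w₀∈S₂
  ... | x , x₀≡1 , uncovered with T-covers x (nonzero-witness x₀≡1)
  ...   | k , k≤3 , p , p∈T , c , x≗ = uncovered k k≤3 (transfer T⊆S₂ w₀∉T (combination p p∈T c x≗))

module Saturation {q : ℕ} (𝔽 : FiniteField q) where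

  open FiniteField 𝔽
  open FiniteFieldFacts 𝔽
  open ConicSecants 𝔽
  open Combinations 𝔽
  open Covering 𝔽
  open Witnesses 𝔽

  -- S₂ is 2-saturating: points of M₂ use the extra point e₅.
  S₂-covers : GoodOrder → Covers 2 S₂
  S₂-covers good x _ with covered-or-M₂ good x
  ... | inj₁ (k , k≤3 , p , p∈SG , c , x≗) = k , k≤3 , p , (λ i → SG⊆S₂ _ (p∈SG i)) , c , x≗
  ... | inj₂ (x₄≡0 , _ , ¬M₁) = covered-resp {X = S₂} (vec-η x) (covered ℕP.≤-refl
          (combine (combination-mono SG⊆S₂ (solid-two good _ _ _ _ (¬M₁⇒NotM₁ ¬M₁))) (one-g (x ℓ₅) S₂-g)
            (x≡x+0 _) (x≡x+0 _) (x≡x+0 _) (x≡x+0 _) (trans x₄≡0 0≡0+0) (x≡0+x _)))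

  S₂-not-1-saturating : ∀ ρ′ → suc ρ′ ≤ 2 → ¬ Covers ρ′ S₂
  S₂-not-1-saturating ρ′ ρ′<2 covers with covers (vec 1# 0# 1# 0# 1# 0#) (nonzero-witness refl)
  ... | k , k≤ρ′+1 , p , p∈S₂ , c , x≗ = not-1-covered k (ℕP.≤-trans k≤ρ′+1 ρ′<2) (combination p p∈S₂ c x≗)

  S₂-minimal-saturating : GoodOrder → MinimalSaturating 2 S₂
  S₂-minimal-saturating good = (S₂-covers good , S₂-not-1-saturating) , minimal

  -- Part (ii): the points not 2-covered by S₂ ∖ {e₅} lie in M₂, and M₂
  -- contains 2-covered points, e.g. (0, 0, 1, 1, 0, 1) = D + (e₃ + e₅).
  uncovered⊆M₂ : GoodOrder → ∀ v → NonZeroV v → ¬ Covered 2 SG v → M₂ v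
  uncovered⊆M₂ good v _ not-covered with covered-or-M₂ good v
  ... | inj₁ covered = ⊥-elim (not-covered covered)
  ... | inj₂ m = m

  covered-point-of-M₂ : GoodOrder → Σ V λ v → NonZeroV v × M₂ v × Covered 2 SG v
  covered-point-of-M₂ good = vec 0# 0# 1# 1# 0# 1# , nonzero , (refl , 1≢0 , λ m → 1≢0 (proj₁ m)) ,
    covered ℕP.≤-refl (combine (conic₂-secant (secant-z≡0 (3<q good) 1≢0 1≢0)) (one-d 1# SG-d)
      0≡0+0 0≡0+0 (x≡0+x 1#) (x≡x+0 1#) 0≡0+0 (x≡x+0 1#))
    where nonzero : NonZeroV (vec 0# 0# 1# 1# 0# 1#)
          nonzero v≗0 = 1≢0 (v≗0 ℓ₂)

  -- Points of M₂ are covered with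
  -- four points: a two-point combination in ⟨e₀, …, e₃⟩ and one on a secant
  -- of the conic {E a}, or e₅ (three points) and one point of ⟨e₀, e₁⟩.
  M₂-three-covered : GoodOrder → ∀ x₀ x₁ x₂ x₃ {x₅} → x₅ ≢ 0# → Combination 4 SG (vec x₀ x₁ x₂ x₃ 0# x₅)
  M₂-three-covered good x₀ x₁ x₂ x₃ {x₅} x₅≢0 with x₃ ≟ 0#
  ... | no x₃≢0 = combine (solid-two good x₀ x₁ x₂ 0# (inj₂ (inj₁ refl))) (conic₂-secant (secant-z≡0 (3<q good) x₃≢0 x₅≢0))
          (x≡x+0 x₀) (x≡x+0 x₁) (x≡x+0 x₂) (x≡0+x x₃) 0≡0+0 (x≡0+x x₅)
  ... | yes x₃≡0 with M₁? x₀ x₁ x₂ (- 1#)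
  ...   | inj₂ notM₁ = combine (solid-two good x₀ x₁ x₂ (- 1#) notM₁) (conic₂-secant (secant-z≡0 (3<q good) 1≢0 x₅≢0))
          (x≡x+0 x₀) (x≡x+0 x₁) (x≡x+0 x₂) (trans x₃≡0 (sym (-1+1 1#))) 0≡0+0 (x≡0+x x₅)
    where -1+1 : ∀ a → - a + a ≡ 0#
          -1+1 = solve 1 (λ a → :- a :+ a := c0) refl
  ...   | inj₁ (x₂≡0 , _ , ¬exc) = combine (axis₅ good x₅) (line-one (¬exception⇒line-covered ¬exc))
          (x≡0+x x₀) (x≡0+x x₁) (trans x₂≡0 0≡0+0) (trans x₃≡0 0≡0+0) 0≡0+0 (x≡x+0 x₅)

  SG-covers : GoodOrder → Covers 3 SG
  SG-covers good x _ with covered-or-M₂ good x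
  ... | inj₁ (k , k≤3 , cover) = k , ℕP.≤-trans k≤3 (ℕP.n≤1+n 3) , cover
  ... | inj₂ (x₄≡0 , x₅≢0 , _) = covered-resp {X = SG} (≗-trans (vec-η x) (coordinatewise refl refl refl refl x₄≡0 refl))
          (covered ℕP.≤-refl (M₂-three-covered good (x ℓ₀) (x ℓ₁) (x ℓ₂) (x ℓ₃) x₅≢0))

  SG-not-2-saturating : ∀ ρ′ → suc ρ′ ≤ 3 → ¬ Covers ρ′ SG
  SG-not-2-saturating ρ′ ρ′<3 covers with covers (vec 1# 0# 1# 0# 0# 1#) (nonzero-witness refl)
  ... | k , k≤ρ′+1 , p , p∈SG , c , x≗ = without-g Pg-vec k (ℕP.≤-trans k≤ρ′+1 ρ′<3) (combination p p∈SG c x≗)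

  SG-saturating : GoodOrder → Saturating 3 SG
  SG-saturating good = SG-covers good , SG-not-2-saturating

module Sizes {q : ℕ} (𝔽 : FiniteField q) where

  open FiniteField 𝔽
  open FiniteFieldFacts 𝔽
  open Combinations 𝔽

  size-via : ∀ {n X} {I : Set} → Fin n ↔ I → (point : I → V) → (∀ b → X (point b)) →
             (∀ w → X w → Σ I λ b → Proportional w (point b)) →
             (∀ b b′ → Proportional (point b) (point b′) → b ≡ b′) → HasSize n X
  size-via bij point point∈X onto distinct =
    (λ i → point (to i)) , (λ i → point∈X (to i)) ,
    (λ w w∈X → from (proj₁ (onto w w∈X)) , subst (λ b → Proportional w (point b)) (sym (strictlyInverseˡ _)) (proj₂ (onto w w∈X))) ,
    (λ i j pr → trans (sym (strictlyInverseʳ i)) (trans (cong from (distinct _ _ pr)) (strictlyInverseʳ j)))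
    where open Inverse bij

  -- The points of S₂ ∖ {e₅} come in three blocks A ∪ B, C ∪ D, E ∪ F, each
  -- indexed by the field: the parameter 0 stands for the point A, D, F.
  Index : Set
  Index = Fin 3 × Carrier

  axis-or-curve : V → (Carrier → V) → Carrier → V
  axis-or-curve axis curve a with a ≟ 0#
  ... | yes _ = axis
  ... | no _ = curve a

  axis-or-curve-view : ∀ axis curve a → (a ≡ 0# × axis-or-curve axis curve a ≡ axis) ⊎ (a ≢ 0# × axis-or-curve axis curve a ≡ curve a)
  axis-or-curve-view axis curve a with a ≟ 0#
  ... | yes a≡0 = inj₁ (a≡0 , refl)
  ... | no a≢0 = inj₂ (a≢0 , refl)

  point : Index → V
  point (zero , a) = axis-or-curve Pa Pb a
  point (suc zero , a) = axis-or-curve Pd Pc a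
  point (suc (suc zero) , a) = axis-or-curve Pf Pe a

  point₊ : Index ⊎ ⊤ → V
  point₊ (inj₁ b) = point b
  point₊ (inj₂ tt) = Pg

  if-zero : {A : Set} → Carrier → A → A → A
  if-zero x e f with x ≟ 0#
  ... | yes _ = e
  ... | no _ = f

  if-zero-yes : ∀ {A : Set} {x} {e f : A} → x ≡ 0# → if-zero x e f ≡ e
  if-zero-yes {x = x} x≡0 with x ≟ 0#
  ... | yes _ = refl
  ... | no x≢0 = ⊥-elim (x≢0 x≡0)

  if-zero-no : ∀ {A : Set} {x} {e f : A} → x ≢ 0# → if-zero x e f ≡ f
  if-zero-no {x = x} x≢0 with x ≟ 0#
  ... | yes x≡0 = ⊥-elim (x≢0 x≡0)
  ... | no _ = refl

  -- Decoding: the index of a point is recovered from its first nonzero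
  -- coordinate and the ratio of the next coordinate to it.
  decode : V → Index ⊎ ⊤
  decode v =
    if-zero (v ℓ₀)
      (if-zero (v ℓ₁)
        (if-zero (v ℓ₂)
          (if-zero (v ℓ₃)
            (if-zero (v ℓ₄) (inj₂ tt) (inj₁ (suc (suc zero) , 0#)))
            (inj₁ (suc (suc zero) , v ℓ₄ * v ℓ₃ ⁻¹)))
          (inj₁ (suc zero , 0#)))
        (inj₁ (suc zero , v ℓ₂ * v ℓ₁ ⁻¹)))
      (inj₁ (zero , v ℓ₁ * v ℓ₀ ⁻¹))

  private
    multiple-of-0 : ∀ {c x} → x ≡ c * 0# → x ≡ 0#
    multiple-of-0 {c} e = trans e (zeroʳ c)

    multiple-of-1 : ∀ {c x} → c ≢ 0# → x ≡ c * 1# → x ≢ 0#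
    multiple-of-1 {c} c≢0 e x≡0 = c≢0 (trans (sym (*-identityʳ c)) (trans (sym e) x≡0))

    ratio : ∀ {c a x y} → c ≢ 0# → x ≡ c * 1# → y ≡ c * a → y * x ⁻¹ ≡ a
    ratio {c} {a} {x} {y} c≢0 x≡c y≡ca = begin
      y * x ⁻¹        ≡⟨ cong₂ (λ u w → u * w ⁻¹) y≡ca (trans x≡c (*-identityʳ c)) ⟩
      (c * a) * c ⁻¹  ≡⟨ cong (_* c ⁻¹) (*-comm c a) ⟩
      (a * c) * c ⁻¹  ≡⟨ *-assoc a c _ ⟩
      a * (c * c ⁻¹)  ≡⟨ cong (a *_) (⁻¹-inverseʳ c≢0) ⟩
      a * 1#          ≡⟨ *-identityʳ a ⟩
      a               ∎
      where open ≡-Reasoning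

    coordinates : ∀ {c v p m} → v ≗ c · p → p ≗ m → ∀ i → v i ≡ c * m i
    coordinates {c} v≗ p≗ i = trans (v≗ i) (cong (c *_) (p≗ i))

    via : ∀ {c v p p′} → v ≗ c · p → p ≡ p′ → v ≗ c · p′
    via {c} v≗ refl = v≗

  decode-multiple : ∀ b {c v} → c ≢ 0# → v ≗ c · point₊ b → decode v ≡ b
  decode-multiple (inj₁ (zero , a)) {c} c≢0 v≗ with axis-or-curve-view Pa Pb a
  ... | inj₁ (a≡0 , is-a) = trans (if-zero-no (multiple-of-1 c≢0 (at ℓ₀)))
                              (cong (λ r → inj₁ (zero , r)) (ratio c≢0 (at ℓ₀) (trans (at ℓ₁) (cong (c *_) (sym a≡0)))))
    where at = coordinates (via v≗ is-a) Pa-vec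
  ... | inj₂ (_ , is-b) = trans (if-zero-no (multiple-of-1 c≢0 (at ℓ₀))) (cong (λ r → inj₁ (zero , r)) (ratio c≢0 (at ℓ₀) (at ℓ₁)))
    where at = coordinates (via v≗ is-b) (Pb-vec a)
  decode-multiple (inj₁ (suc zero , a)) {c} c≢0 v≗ with axis-or-curve-view Pd Pc a
  ... | inj₁ (a≡0 , is-d) = trans (if-zero-yes (multiple-of-0 (at ℓ₀))) (trans (if-zero-yes (multiple-of-0 (at ℓ₁)))
                              (trans (if-zero-no (multiple-of-1 c≢0 (at ℓ₂))) (cong (λ r → inj₁ (suc zero , r)) (sym a≡0))))
    where at = coordinates (via v≗ is-d) Pd-vec
  ... | inj₂ (_ , is-c) = trans (if-zero-yes (multiple-of-0 (at ℓ₀))) (trans (if-zero-no (multiple-of-1 c≢0 (at ℓ₁)))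
                              (cong (λ r → inj₁ (suc zero , r)) (ratio c≢0 (at ℓ₁) (at ℓ₂))))
    where at = coordinates (via v≗ is-c) (Pc-vec a)
  decode-multiple (inj₁ (suc (suc zero) , a)) {c} c≢0 v≗ with axis-or-curve-view Pf Pe a
  ... | inj₁ (a≡0 , is-f) = trans (if-zero-yes (multiple-of-0 (at ℓ₀))) (trans (if-zero-yes (multiple-of-0 (at ℓ₁)))
                              (trans (if-zero-yes (multiple-of-0 (at ℓ₂))) (trans (if-zero-yes (multiple-of-0 (at ℓ₃)))
                              (trans (if-zero-no (multiple-of-1 c≢0 (at ℓ₄))) (cong (λ r → inj₁ (suc (suc zero) , r)) (sym a≡0))))))
    where at = coordinates (via v≗ is-f) Pf-vec
  ... | inj₂ (_ , is-e) = trans (if-zero-yes (multiple-of-0 (at ℓ₀))) (trans (if-zero-yes (multiple-of-0 (at ℓ₁)))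
                              (trans (if-zero-yes (multiple-of-0 (at ℓ₂))) (trans (if-zero-no (multiple-of-1 c≢0 (at ℓ₃)))
                              (cong (λ r → inj₁ (suc (suc zero) , r)) (ratio c≢0 (at ℓ₃) (at ℓ₄))))))
    where at = coordinates (via v≗ is-e) (Pe-vec a)
  decode-multiple (inj₂ tt) {c} c≢0 v≗ = trans (if-zero-yes (multiple-of-0 (at ℓ₀))) (trans (if-zero-yes (multiple-of-0 (at ℓ₁)))
    (trans (if-zero-yes (multiple-of-0 (at ℓ₂))) (trans (if-zero-yes (multiple-of-0 (at ℓ₃))) (if-zero-yes (multiple-of-0 (at ℓ₄))))))
    where at = coordinates v≗ Pg-vec

  point₊-distinct : ∀ b b′ → Proportional (point₊ b) (point₊ b′) → b ≡ b′
  point₊-distinct b b′ (c , c≢0 , b≗cb′) =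
    trans (sym (decode-multiple b 1≢0 (λ i → sym (*-identityˡ _)))) (decode-multiple b′ c≢0 b≗cb′)

  point-distinct : ∀ b b′ → Proportional (point b) (point b′) → b ≡ b′
  point-distinct b b′ pr = inj₁-injective (point₊-distinct (inj₁ b) (inj₁ b′) pr)

  axis-point : ∀ {axis curve} → axis-or-curve axis curve 0# ≡ axis
  axis-point {axis} {curve} with axis-or-curve-view axis curve 0#
  ... | inj₁ (_ , is-axis) = is-axis
  ... | inj₂ (0≢0 , _) = ⊥-elim (0≢0 refl)

  curve-point : ∀ {axis curve a} → a ≢ 0# → axis-or-curve axis curve a ≡ curve a
  curve-point {axis} {curve} {a} a≢0 with axis-or-curve-view axis curve a
  ... | inj₁ (a≡0 , _) = ⊥-elim (a≢0 a≡0)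
  ... | inj₂ (_ , is-curve) = is-curve

  point∈SG : ∀ b → SG (point b)
  point∈SG (zero , a) with axis-or-curve-view Pa Pb a
  ... | inj₁ (_ , is-a) = subst SG (sym is-a) SG-a
  ... | inj₂ (a≢0 , is-b) = subst SG (sym is-b) (SG-b a≢0)
  point∈SG (suc zero , a) with axis-or-curve-view Pd Pc a
  ... | inj₁ (_ , is-d) = subst SG (sym is-d) SG-d
  ... | inj₂ (a≢0 , is-c) = subst SG (sym is-c) (SG-c a≢0)
  point∈SG (suc (suc zero) , a) with axis-or-curve-view Pf Pe a
  ... | inj₁ (_ , is-f) = subst SG (sym is-f) SG-f
  ... | inj₂ (a≢0 , is-e) = subst SG (sym is-e) (SG-e a≢0)

  point₊∈S₂ : ∀ b → S₂ (point₊ b)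
  point₊∈S₂ (inj₁ b) = SG⊆S₂ _ (point∈SG b)
  point₊∈S₂ (inj₂ tt) = S₂-g

  equal⇒proportional : ∀ {w p : V} {p′} → w ≗ p → p′ ≡ p → Proportional w p′
  equal⇒proportional w≗p refl = 1# , 1≢0 , λ i → trans (w≗p i) (sym (*-identityˡ _))

  onto₊ : ∀ w → S₂ w → Σ (Index ⊎ ⊤) λ b → Proportional w (point₊ b)
  onto₊ w (inj₁ w≗) = inj₁ (zero , 0#) , equal⇒proportional w≗ axis-point
  onto₊ w (inj₂ (inj₁ (a , a≢0 , w≗))) = inj₁ (zero , a) , equal⇒proportional w≗ (curve-point a≢0)
  onto₊ w (inj₂ (inj₂ (inj₁ (a , a≢0 , w≗)))) = inj₁ (suc zero , a) , equal⇒proportional w≗ (curve-point a≢0)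
  onto₊ w (inj₂ (inj₂ (inj₂ (inj₁ w≗)))) = inj₁ (suc zero , 0#) , equal⇒proportional w≗ axis-point
  onto₊ w (inj₂ (inj₂ (inj₂ (inj₂ (inj₁ (a , a≢0 , w≗)))))) = inj₁ (suc (suc zero) , a) , equal⇒proportional w≗ (curve-point a≢0)
  onto₊ w (inj₂ (inj₂ (inj₂ (inj₂ (inj₂ (inj₁ w≗)))))) = inj₁ (suc (suc zero) , 0#) , equal⇒proportional w≗ axis-point
  onto₊ w (inj₂ (inj₂ (inj₂ (inj₂ (inj₂ (inj₂ w≗)))))) = inj₂ tt , equal⇒proportional w≗ refl

  onto : ∀ w → SG w → Σ Index λ b → Proportional w (point b)
  onto w (w∈S₂ , w≁e₅) with onto₊ w w∈S₂
  ... | inj₁ b , w∼b = b , w∼b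
  ... | inj₂ tt , w∼e₅ = ⊥-elim (w≁e₅ w∼e₅)

  index↔ : Fin (3 ℕ.* q) ↔ Index
  index↔ = ↔-trans *↔× (↔-refl ×-↔ enumeration)

  size-SG : HasSize (3 ℕ.* q) SG
  size-SG = size-via index↔ point point∈SG onto point-distinct

  size-S₂ : HasSize (3 ℕ.* q ℕ.+ 1) S₂
  size-S₂ = size-via (↔-trans +↔⊎ (index↔ ⊎-↔ 1↔⊤)) point₊ point₊∈S₂ onto₊ point₊-distinct

open import Data.Nat using (ℕ; _≤_; _+_; _*_)

proposition3p3 : (q : ℕ) → (𝔽 : FiniteField q) → (q ≡ 4 ⊎ 7 ≤ q) →
    let open PG5 𝔽 in
    (HasSize (3 * q + 1) S₂ × MinimalSaturating 2 S₂)
    × ((∀ v → NonZeroV v → ¬ Covered 2 (S₂ ∖ₚ e ℓ₅) v → M₂ v)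
    × Σ V (λ v → NonZeroV v × M₂ v × Covered 2 (S₂ ∖ₚ e ℓ₅) v))
    × (HasSize (3 * q) (S₂ ∖ₚ e ℓ₅) × Saturating 3 (S₂ ∖ₚ e ℓ₅))
proposition3p3 q 𝔽 good =
    (size-S₂ , S₂-minimal-saturating good)
  , (uncovered⊆M₂ good , covered-point-of-M₂ good)
  , (size-SG , SG-saturating good)
  where
  open Saturation 𝔽
  open Sizes 𝔽
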